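{- Let $i,j\geq 0$ be integers and $L$ a finite set of integers. The map $\operatorname{split}:T\mapsto\{T[k] : k\in Free(T)\}$ is a bijection between: - (1) alternative tableaux labeled by $L$ having exactly $i$ free rows and $j$ free columns; and - (2) sets of $i+j$ labeled packed tableaux, $i$ of which have exactly one free row and no free column and $j$ of which have no free row and exactly one free column, whose $i+j$ label sets form a partition of $L$. The inverse bijection is given by $\operatorname{merge}$, i.e. by merging all tableaux of the set.
   Context: A shape of length $n$ is a Ferrers diagram in English notation, possibly with empty rows or columns. It is determined by its south-east border, a path of $n$ unit south/west steps from the top-right corner to the bottom-left corner. South steps correspond to rows and west steps to columns. The shape is labeled by a set of integers $L=\{i_1<\dots<i_n\}$ if $i_1,\dots,i_n$ are attached to the rows and columns in the order in which their steps occur along the south-east border from top-right to bottom-left. A cell in row $i$ and column $j$ exists iff $i<j$; it is denoted $(i,j)$. An alternative tableau is a shape with a partial filling of cells by left arrows and up arrows such that every cell to the left of a left arrow in its row, and every cell above an up arrow in its column, is empty. A free row is a row with no left arrow; a free column is a column with no up arrow. $Free(T)$ is the set of labels of free rows and free columns. A packed tableau is an alternative tableau of length $n>0$ with either no free row and exactly one free column, or exactly one free row and no free column. For $k\in Free(T)$, $T(k)$ is the smallest $X\subseteq L$ with $k\in X$ such that, for every cell $(i,j)$ containing an arrow, $i\in X$ iff $j\in X$. For $A\subseteq L$, $T[A]$ is the labeled tableau with label set $A$ in which $l\in A$ labels a row (resp. column) iff it does so in $T$, and each cell $(i,j)$ has the same filling as in $T$. We write $T[k]:=T[T(k)]$.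 For $T,T'$ labeled by disjoint sets $L,L'$, $\operatorname{merge}(T,T')$ is the labeled tableau with label set $L\cup L'$, where a label is a row iff it is a row in $T$ or $T'$. A cell $(i,j)$ of it carries a left (resp. up) arrow iff either $i,j\in L$ and $(i,j)$ carries that arrow in $T$, or $i,j\in L'$ and $(i,j)$ carries that arrow in $T'$; all other cells are empty. This operation is symmetric and associative, so a finite collection of tableaux with pairwise disjoint label sets can be merged. -}

module Defs where

open import Data.Bool using (Bool; true; false; _∧_; _∨_; not; if_then_else_)
open import Data.Nat using (ℕ)
open import Data.Integer using (ℤ; _<_; _≤_; _≤?_; _<?_)
import Data.Integer as ℤ
open import Data.List using (List; []; _∷_; map; filterᵇ; length; merge; _++_; concatMap; foldr)
open import Data.List.Relation.Unary.Linked using (Linked)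
open import Data.List.Relation.Unary.All using (All)
open import Data.List.Relation.Unary.Unique.Propositional using (Unique)
open import Data.List.Membership.Propositional using (_∈_)
open import Data.List.Relation.Binary.Permutation.Propositional using (_↭_)
open import Data.Product using (_×_; _,_; proj₁; proj₂; Σ)
open import Data.Sum using (_⊎_)
open import Relation.Binary.PropositionalEquality using (_≡_)
open import Relation.Nullary using (¬_; does; Dec)
open import Relation.Nullary.Decidable using (⌊_⌋)
open import Relation.Binary using (Rel; Decidable)

-- A labeled tableau is given by its label set, each label tagged as a
-- row or a column (this determines the shape: labels listed in
-- increasing order give the south-east border, row = south step,
-- column = west step), together with the list of its arrows
-- (i , j , a) meaning that cell (i,j) (row i, column j) carries arrow a.
-- Canonical form (see WF): labels strictly increasing, arrows strictly
-- increasing lexicographically in (i , j); hence two well-formed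
-- tableaux are equal iff they have the same labels/rows/columns and the
-- same filling, and propositional equality _≡_ is equality of tableaux.

data RC : Set where
  row col : RC

data Arrow : Set where
  left up : Arrow

record Tableau : Set where
  constructor tab
  field
    labels : List (ℤ × RC)
    arrows : List (ℤ × ℤ × Arrow)
open Tableau public

any : {A : Set} → (A → Bool) → List A → Bool
any p = foldr (λ x b → p x ∨ b) false

all : {A : Set} → (A → Bool) → List A → Bool
all p = foldr (λ x b → p x ∧ b) true

_==_ : ℤ → ℤ → Bool
a == b = ⌊ a ℤ.≟ b ⌋

isRowᵇ : RC → Bool
isRowᵇ row = true
isRowᵇ col = false

isColᵇ : RC → Bool
isColᵇ c = not (isRowᵇ c)

isLeftᵇ : Arrow → Bool
isLeftᵇ left = true
isLeftᵇ up = false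

isUpᵇ : Arrow → Bool
isUpᵇ a = not (isLeftᵇ a)

_∈ᵇ_ : ℤ → List ℤ → Bool
x ∈ᵇ xs = any (λ y → x == y) xs

labelSet : Tableau → List ℤ
labelSet T = map proj₁ (labels T)

_<cell_ : Rel (ℤ × ℤ × Arrow) _
(i , j , _) <cell (i′ , j′ , _) = (i < i′) ⊎ ((i ≡ i′) × (j < j′))

data AlternativeTableau (T : Tableau) : Set where
  mkAlt :
    Linked (λ a b → proj₁ a < proj₁ b) (labels T) →
    Linked _<cell_ (arrows T) →
    -- every arrow sits in an existing cell (i,j): i a row, j a column, i < j
    All (λ { (i , j , _) → ((i , row) ∈ labels T) × ((j , col) ∈ labels T) × (i < j) }) (arrows T) →
    -- cells to the left of a left arrow (same row i, column j′ > j) are empty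
    All (λ { (i , j , a) → a ≡ left →
          All (λ { (i′ , j′ , _) → i′ ≡ i → ¬ (j < j′) }) (arrows T) }) (arrows T) →
    -- cells above an up arrow (same column j, row i′ < i) are empty
    All (λ { (i , j , a) → a ≡ up →
          All (λ { (i′ , j′ , _) → j′ ≡ j → ¬ (i′ < i) }) (arrows T) }) (arrows T) →
    AlternativeTableau T

isFreeRowᵇ : Tableau → ℤ → Bool
isFreeRowᵇ T r = not (any (λ { (i , _ , a) → (i == r) ∧ isLeftᵇ a }) (arrows T))

isFreeColᵇ : Tableau → ℤ → Bool
isFreeColᵇ T c = not (any (λ { (_ , j , a) → (j == c) ∧ isUpᵇ a }) (arrows T))

freeRows : Tableau → List ℤ
freeRows T = map proj₁ (filterᵇ (λ { (l , k) → isRowᵇ k ∧ isFreeRowᵇ T l }) (labels T))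

freeCols : Tableau → List ℤ
freeCols T = map proj₁ (filterᵇ (λ { (l , k) → isColᵇ k ∧ isFreeColᵇ T l }) (labels T))

Free : Tableau → List ℤ
Free T = map proj₁ (filterᵇ (λ { (l , k) → (isRowᵇ k ∧ isFreeRowᵇ T l) ∨ (isColᵇ k ∧ isFreeColᵇ T l) }) (labels T))

-- T(k): the smallest X ⊆ L with k ∈ X such that for every arrow (i,j),
-- i ∈ X iff j ∈ X.  Computed literally as the intersection of all such
-- subsets X of L (there are finitely many).

subsets : {A : Set} → List A → List (List A)
subsets [] = [] ∷ []
subsets (x ∷ xs) = let s = subsets xs in map (x ∷_) s ++ s

closedᵇ : Tableau → List ℤ → Bool
closedᵇ T X = all (λ { (i , j , _) → ⌊ Data.Bool._≟_ (i ∈ᵇ X) (j ∈ᵇ X) ⌋ }) (arrows T)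
  where import Data.Bool

component : Tableau → ℤ → List ℤ
component T k =
  let cands = filterᵇ (λ X → (k ∈ᵇ X) ∧ closedᵇ T X) (subsets (labelSet T))
  in filterᵇ (λ l → all (λ X → l ∈ᵇ X) cands) (labelSet T)

restrict : Tableau → List ℤ → Tableau
restrict T A = tab (filterᵇ (λ { (l , _) → l ∈ᵇ A }) (labels T))
                   (filterᵇ (λ { (i , j , _) → (i ∈ᵇ A) ∧ (j ∈ᵇ A) }) (arrows T))

restrictAt : Tableau → ℤ → Tableau
restrictAt T k = restrict T (component T k)

-- split(T) = { T[k] : k ∈ Free(T) }, a finite set represented by a list
split : Tableau → List Tableau
split T = map (restrictAt T) (Free T)

_≤lab?_ : (a b : ℤ × RC) → Dec (proj₁ a ≤ proj₁ b)
a ≤lab? b = proj₁ a ≤? proj₁ b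

cellLeqᵇ : (ℤ × ℤ × Arrow) → (ℤ × ℤ × Arrow) → Bool
cellLeqᵇ (i , j , _) (i′ , j′ , _) = ⌊ i <? i′ ⌋ ∨ ((i == i′) ∧ ⌊ j ≤? j′ ⌋)

_≤cell?_ : (a b : ℤ × ℤ × Arrow) → Dec (Data.Bool.T (cellLeqᵇ a b))
a ≤cell? b = Data.Bool.T? (cellLeqᵇ a b)
  where import Data.Bool

ownArrows : Tableau → List (ℤ × ℤ × Arrow)
ownArrows T = filterᵇ (λ { (i , j , _) → (i ∈ᵇ labelSet T) ∧ (j ∈ᵇ labelSet T) }) (arrows T)

merge₂ : Tableau → Tableau → Tableau
merge₂ T T′ = tab (merge _≤lab?_ (labels T) (labels T′))
                  (merge _≤cell?_ (ownArrows T) (ownArrows T′))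

emptyTableau : Tableau
emptyTableau = tab [] []

mergeAll : List Tableau → Tableau
mergeAll = foldr merge₂ emptyTableau

countᵇ : {A : Set} → (A → Bool) → List A → ℕ
countᵇ p xs = length (filterᵇ p xs)

Side1 : List ℤ → ℕ → ℕ → Tableau → Set
Side1 L i j T = AlternativeTableau T × (labelSet T ≡ L)
              × (length (freeRows T) ≡ i) × (length (freeCols T) ≡ j)

oneRowNoColᵇ : Tableau → Bool
oneRowNoColᵇ T = ⌊ length (freeRows T) Data.Nat.≟ 1 ⌋ ∧ ⌊ length (freeCols T) Data.Nat.≟ 0 ⌋
  where import Data.Nat

noRowOneColᵇ : Tableau → Bool
noRowOneColᵇ T = ⌊ length (freeRows T) Data.Nat.≟ 0 ⌋ ∧ ⌊ length (freeCols T) Data.Nat.≟ 1 ⌋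
  where import Data.Nat

Packed : Tableau → Set
Packed T = AlternativeTableau T × (0 Data.Nat.< length (labels T))
         × ((length (freeRows T) ≡ 0 × length (freeCols T) ≡ 1)
            ⊎ (length (freeRows T) ≡ 1 × length (freeCols T) ≡ 0))
  where import Data.Nat

Side2 : List ℤ → ℕ → ℕ → List Tableau → Set
Side2 L i j S = Unique S × All Packed S × (length S ≡ i Data.Nat.+ j)
              × (countᵇ oneRowNoColᵇ S ≡ i) × (countᵇ noRowOneColᵇ S ≡ j)
              × (concatMap labelSet S ↭ L)
  where import Data.Nat

module Submission where

-- In an alternative tableau every label has at most one successor (a row:
-- the column of its left arrow; a column: the row of its up arrow), and a
-- step row → column → row strictly raises the row.  So the walk from any
-- label stops at a free label, its root.  The two ends of an arrow have
-- the same root and arrow-closed sets are closed under walks, hence for a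
-- free label k the set T(k) is the tree {l : root l = k}.  Thus split T
-- restricts T to the trees of its free labels; each piece has its root as
-- only free label, hence is packed, and merging the pieces gives back T.
-- Conversely, in the merge M of packed tableaux with disjoint labels every
-- arrow lies in one member, so freeness is decided in the members, and for
-- the free label k of a member P the set M(k) is the label set of P, so
-- M[k] = P.

open import Defs
open import Data.Nat using (ℕ)
open import Data.Integer using (ℤ; _<_)
open import Data.List using (List)
open import Data.List.Relation.Unary.Linked using (Linked)
open import Data.List.Relation.Binary.BagAndSetEquality using (_∼[_]_; set)
open import Data.Product using (_×_)
open import Relation.Binary.PropositionalEquality using (_≡_)

open import Data.Bool using (Bool; true; false; _∧_; _∨_; not; T; T?; if_then_else_)
open import Data.Bool.Properties using (T-≡; T-∨; T-∧; ∨-zeroʳ; ∧-zeroʳ; ∨-identityʳ; ∧-identityʳ)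
open import Data.Maybe using (Maybe; just; nothing; maybe′)
open import Data.Nat as ℕ using (zero; suc; _+_; _*_)
import Data.Nat.Properties as ℕₚ
import Data.Integer as ℤ
import Data.Integer.Properties as ℤₚ
open import Data.List using ([]; _∷_; map; filterᵇ; length; _++_; concatMap; merge)
import Data.List.Properties as Listₚ
open import Data.List.Membership.Propositional using (_∈_)
open import Data.List.Membership.Propositional.Properties using (∈-concat⁺′; ∈-concat⁻′; ∈-map⁺; ∈-map⁻; ∈-++⁺ˡ; ∈-++⁺ʳ; ∈-++⁻; ∈-filter⁺; ∈-filter⁻)
open import Data.List.Relation.Unary.Any using (here; there)
open import Data.List.Relation.Unary.All as All using (All; []; _∷_)
import Data.List.Relation.Unary.All.Properties as Allₚ
open import Data.List.Relation.Unary.AllPairs as AllPairs using (AllPairs; []; _∷_)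
open import Data.List.Relation.Unary.Linked as Linked using ([]; [-])
import Data.List.Relation.Unary.Linked.Properties as Linkedₚ
open import Data.List.Relation.Unary.Unique.Propositional using (Unique)
open import Data.List.Relation.Binary.Permutation.Propositional using (_↭_; ↭-sym; ↭-trans; ↭-refl; ↭-prep; ↭⇒↭ₛ)
import Data.List.Relation.Binary.Permutation.Propositional.Properties as Permₚ
import Data.List.Relation.Binary.Permutation.Setoid.Properties as PermSₚ
open import Data.Product using (_,_; proj₁; proj₂; ∃-syntax)
open import Data.Sum as Sum using (_⊎_; inj₁; inj₂)
open import Data.Empty using (⊥; ⊥-elim)
open import Function using (_∘_)
open import Function.Bundles using (Equivalence; mk⇔)
open import Level using (0ℓ)
open import Relation.Binary using (Rel; Decidable; Transitive; tri<; tri≈; tri>)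
open import Relation.Binary.PropositionalEquality using (_≢_; refl; sym; trans; cong; cong₂; subst; setoid; module ≡-Reasoning)
open import Relation.Nullary using (¬_; yes; no)
open import Relation.Nullary.Decidable using (⌊_⌋; toWitness; fromWitness; isYes≗does; dec-true; dec-false)

private variable
  A B : Set

true≢false : ¬ (true ≡ false)
true≢false ()

∧-true⁻ : ∀ {a b} → a ∧ b ≡ true → a ≡ true × b ≡ true
∧-true⁻ {true} {true} _ = refl , refl

∧-true⁺ : ∀ {a b} → a ≡ true → b ≡ true → a ∧ b ≡ true
∧-true⁺ refl refl = refl

==⇒≡ : ∀ {a b} → (a == b) ≡ true → a ≡ b
==⇒≡ {a} {b} p with a ℤ.≟ b
... | yes q = q

==-refl : ∀ a → (a == a) ≡ true
==-refl a with a ℤ.≟ a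
... | yes _ = refl
... | no q = ⊥-elim (q refl)

any-true⁻ : ∀ (p : A → Bool) xs → any p xs ≡ true → ∃[ x ] (x ∈ xs × p x ≡ true)
any-true⁻ p (x ∷ xs) e with p x in eq
... | true = x , here refl , eq
... | false = let y , m , q = any-true⁻ p xs e in y , there m , q

any-true⁺ : ∀ (p : A → Bool) {x} xs → x ∈ xs → p x ≡ true → any p xs ≡ true
any-true⁺ p (x ∷ xs) (here refl) q rewrite q = refl
any-true⁺ p (x ∷ xs) (there m) q rewrite any-true⁺ p xs m q = ∨-zeroʳ (p x)

any-false⁺ : ∀ (p : A → Bool) xs → (∀ {x} → x ∈ xs → p x ≡ false) → any p xs ≡ false
any-false⁺ p [] f = refl
any-false⁺ p (x ∷ xs) f rewrite f (here refl) = any-false⁺ p xs (f ∘ there)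

all-true⁻ : ∀ (p : A → Bool) xs → all p xs ≡ true → ∀ {x} → x ∈ xs → p x ≡ true
all-true⁻ p (x ∷ xs) e (here refl) = proj₁ (∧-true⁻ e)
all-true⁻ p (x ∷ xs) e (there m) = all-true⁻ p xs (proj₂ (∧-true⁻ {p x} e)) m

all-true⁺ : ∀ (p : A → Bool) xs → (∀ {x} → x ∈ xs → p x ≡ true) → all p xs ≡ true
all-true⁺ p [] f = refl
all-true⁺ p (x ∷ xs) f rewrite f (here refl) = all-true⁺ p xs (f ∘ there)

all-false⁺ : ∀ (p : A → Bool) {x} xs → x ∈ xs → p x ≡ false → all p xs ≡ false
all-false⁺ p (x ∷ xs) (here refl) q rewrite q = refl
all-false⁺ p (x ∷ xs) (there m) q rewrite all-false⁺ p xs m q = ∧-zeroʳ (p x)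

any-cong : ∀ (p : A → Bool) xs ys → (∀ {x} → x ∈ xs → p x ≡ true → x ∈ ys) →
  (∀ {y} → y ∈ ys → p y ≡ true → y ∈ xs) → any p xs ≡ any p ys
any-cong p xs ys f g with any p xs in e₁ | any p ys in e₂
... | true | true = refl
... | false | false = refl
... | true | false =
  let x , m , px = any-true⁻ p xs e₁ in ⊥-elim (true≢false (trans (sym (any-true⁺ p ys (f m px) px)) e₂))
... | false | true =
  let y , m , py = any-true⁻ p ys e₂ in ⊥-elim (true≢false (trans (sym (any-true⁺ p xs (g m py) py)) e₁))

any-filter : ∀ (p r : A → Bool) xs → (∀ {x} → x ∈ xs → p x ≡ true → r x ≡ true) →
  any p (filterᵇ r xs) ≡ any p xs
any-filter p r [] f = refl
any-filter p r (x ∷ xs) f with r x in rx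
... | true = cong (p x ∨_) (any-filter p r xs (f ∘ there))
... | false with p x in px
... | true = ⊥-elim (true≢false (trans (sym (f (here refl) px)) rx))
... | false = any-filter p r xs (f ∘ there)

∈ᵇ⇒∈ : ∀ {x} xs → (x ∈ᵇ xs) ≡ true → x ∈ xs
∈ᵇ⇒∈ {x} xs e with any-true⁻ (x ==_) xs e
... | y , m , q rewrite ==⇒≡ q = m

∈⇒∈ᵇ : ∀ {x} xs → x ∈ xs → (x ∈ᵇ xs) ≡ true
∈⇒∈ᵇ {x} xs m = any-true⁺ (x ==_) xs m (==-refl x)

filter-∈⁻ : ∀ (p : A → Bool) {x} xs → x ∈ filterᵇ p xs → x ∈ xs × p x ≡ true
filter-∈⁻ p xs m = let m′ , t = ∈-filter⁻ (T? ∘ p) m in m′ , Equivalence.to T-≡ t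

filter-∈⁺ : ∀ (p : A → Bool) {x} xs → x ∈ xs → p x ≡ true → x ∈ filterᵇ p xs
filter-∈⁺ p xs m t = ∈-filter⁺ (T? ∘ p) m (Equivalence.from T-≡ t)

∈ᵇ-filter : ∀ (p : ℤ → Bool) x xs → (x ∈ᵇ filterᵇ p xs) ≡ ((x ∈ᵇ xs) ∧ p x)
∈ᵇ-filter p x xs with x ∈ᵇ filterᵇ p xs in e
... | true = let m , px = filter-∈⁻ p xs (∈ᵇ⇒∈ (filterᵇ p xs) e) in sym (∧-true⁺ (∈⇒∈ᵇ xs m) px)
... | false with x ∈ᵇ xs in e₂ | p x in e₃
... | true | true =
  ⊥-elim (true≢false (trans (sym (∈⇒∈ᵇ (filterᵇ p xs) (filter-∈⁺ p xs (∈ᵇ⇒∈ xs e₂) e₃))) e))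
... | true | false = refl
... | false | _ = refl

filter-cong : ∀ (p q : A → Bool) xs → (∀ {x} → x ∈ xs → p x ≡ q x) → filterᵇ p xs ≡ filterᵇ q xs
filter-cong p q [] f = refl
filter-cong p q (x ∷ xs) f rewrite f (here refl) with q x
... | true = cong (x ∷_) (filter-cong p q xs (f ∘ there))
... | false = filter-cong p q xs (f ∘ there)

filter-all : ∀ (p : A → Bool) xs → (∀ {x} → x ∈ xs → p x ≡ true) → filterᵇ p xs ≡ xs
filter-all p [] f = refl
filter-all p (x ∷ xs) f rewrite f (here refl) = cong (x ∷_) (filter-all p xs (f ∘ there))

filter-filter : ∀ (p q : A → Bool) xs → filterᵇ p (filterᵇ q xs) ≡ filterᵇ (λ x → q x ∧ p x) xs
filter-filter p q [] = refl
filter-filter p q (x ∷ xs) with q x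
... | false = filter-filter p q xs
... | true with p x
... | true = cong (x ∷_) (filter-filter p q xs)
... | false = filter-filter p q xs

map-filter : ∀ (f : A → B) (p : B → Bool) xs → map f (filterᵇ (p ∘ f) xs) ≡ filterᵇ p (map f xs)
map-filter f p [] = refl
map-filter f p (x ∷ xs) with p (f x)
... | true = cong (f x ∷_) (map-filter f p xs)
... | false = map-filter f p xs

length-filter-∨ : ∀ (p q : A → Bool) xs → (∀ {x} → x ∈ xs → (p x ∧ q x) ≡ false) →
  length (filterᵇ (λ x → p x ∨ q x) xs) ≡ length (filterᵇ p xs) + length (filterᵇ q xs)
length-filter-∨ p q [] f = refl
length-filter-∨ p q (x ∷ xs) f with p x | q x | f (here refl)
... | true | false | _ = cong suc (length-filter-∨ p q xs (f ∘ there))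
... | false | true | _ = trans (cong suc (length-filter-∨ p q xs (f ∘ there))) (sym (ℕₚ.+-suc _ _))
... | false | false | _ = length-filter-∨ p q xs (f ∘ there)

length-filter-++ : ∀ (p : A → Bool) xs ys →
  length (filterᵇ p (xs ++ ys)) ≡ length (filterᵇ p xs) + length (filterᵇ p ys)
length-filter-++ p xs ys = trans (cong length (Listₚ.filter-++ (T? ∘ p) xs ys)) (Listₚ.length-++ (filterᵇ p xs))

length-filter-↭ : ∀ (p : A → Bool) {xs ys} → xs ↭ ys → length (filterᵇ p xs) ≡ length (filterᵇ p ys)
length-filter-↭ p e = Permₚ.↭-length (Permₚ.filter-↭ (T? ∘ p) e)

filter-partition-↭ : ∀ (p : A → Bool) xs → filterᵇ p xs ++ filterᵇ (not ∘ p) xs ↭ xs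
filter-partition-↭ p [] = ↭-refl
filter-partition-↭ p (x ∷ xs) with p x
... | true = ↭-prep x (filter-partition-↭ p xs)
... | false = ↭-trans (Permₚ.shift x (filterᵇ p xs) (filterᵇ (not ∘ p) xs)) (↭-prep x (filter-partition-↭ p xs))

length-filter-mono : ∀ (p q : A → Bool) xs → (∀ {x} → x ∈ xs → p x ≡ true → q x ≡ true) →
  length (filterᵇ p xs) ℕ.≤ length (filterᵇ q xs)
length-filter-mono p q [] f = ℕ.z≤n
length-filter-mono p q (x ∷ xs) f with p x in ep | q x in eq
... | true | true = ℕ.s≤s (length-filter-mono p q xs (f ∘ there))
... | true | false = ⊥-elim (true≢false (trans (sym (f (here refl) ep)) eq))
... | false | true = ℕₚ.m≤n⇒m≤1+n (length-filter-mono p q xs (f ∘ there))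
... | false | false = length-filter-mono p q xs (f ∘ there)

length-filter-strict : ∀ (p q : A → Bool) xs → (∀ {x} → x ∈ xs → p x ≡ true → q x ≡ true) →
  ∀ {y} → y ∈ xs → p y ≡ false → q y ≡ true → length (filterᵇ p xs) ℕ.< length (filterᵇ q xs)
length-filter-strict p q (x ∷ xs) f (here refl) py qy rewrite py | qy =
  ℕ.s≤s (length-filter-mono p q xs (f ∘ there))
length-filter-strict p q (x ∷ xs) f (there m) py qy with p x in ep | q x in eq
... | true | true = ℕ.s≤s (length-filter-strict p q xs (f ∘ there) m py qy)
... | true | false = ⊥-elim (true≢false (trans (sym (f (here refl) ep)) eq))
... | false | true = ℕₚ.m≤n⇒m≤1+n (length-filter-strict p q xs (f ∘ there) m py qy)
... | false | false = length-filter-strict p q xs (f ∘ there) m py qy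

one-element : ∀ {xs : List A} → length xs ≡ 1 → ∃[ x ] (x ∈ xs × ∀ {y} → y ∈ xs → y ≡ x)
one-element {xs = x ∷ []} _ = x , here refl , λ { (here refl) → refl }

∈-concatMap⁻ : ∀ (f : A → List B) xs {y} → y ∈ concatMap f xs → ∃[ x ] (x ∈ xs × y ∈ f x)
∈-concatMap⁻ f xs m with ∈-concat⁻′ (map f xs) m
... | ys , y∈ys , ys∈ with ∈-map⁻ f ys∈
... | x , x∈xs , refl = x , x∈xs , y∈ys

∈-concatMap⁺ : ∀ (f : A → List B) {xs x y} → x ∈ xs → y ∈ f x → y ∈ concatMap f xs
∈-concatMap⁺ f x∈xs y∈fx = ∈-concat⁺′ y∈fx (∈-map⁺ f x∈xs)

Unique-++-disjoint : ∀ {xs ys : List A} → Unique (xs ++ ys) → ∀ {x y} → x ∈ xs → y ∈ ys → x ≢ y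
Unique-++-disjoint {xs = x ∷ xs} (x∉ ∷ u) (here refl) my = All.lookup x∉ (∈-++⁺ʳ xs my)
Unique-++-disjoint {xs = x ∷ xs} (_ ∷ u) (there mx) my = Unique-++-disjoint u mx my

Unique-++ʳ : ∀ xs {ys : List A} → Unique (xs ++ ys) → Unique ys
Unique-++ʳ [] u = u
Unique-++ʳ (x ∷ xs) (_ ∷ u) = Unique-++ʳ xs u

shared-element⇒same-block : ∀ (f : A → List ℤ) S → Unique (concatMap f S) →
  ∀ {P Q x} → P ∈ S → Q ∈ S → x ∈ f P → x ∈ f Q → P ≡ Q
shared-element⇒same-block f (H ∷ S) u (here refl) (here refl) a b = refl
shared-element⇒same-block f (H ∷ S) u (here refl) (there mQ) a b =
  ⊥-elim (Unique-++-disjoint {xs = f H} u a (∈-concatMap⁺ f mQ b) refl)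
shared-element⇒same-block f (H ∷ S) u (there mP) (here refl) a b =
  ⊥-elim (Unique-++-disjoint {xs = f H} u b (∈-concatMap⁺ f mP a) refl)
shared-element⇒same-block f (H ∷ S) u (there mP) (there mQ) a b =
  shared-element⇒same-block f S (Unique-++ʳ (f H) u) mP mQ a b

blocks-↭ : ∀ {K : Set} (key : K → ℤ) (f : ℤ → ℤ) ks xs → Unique (map key ks) →
  (∀ {x} → x ∈ xs → f x ∈ map key ks) →
  concatMap (λ k → filterᵇ (λ x → f x == key k) xs) ks ↭ xs
blocks-↭ key f [] [] u has-key = ↭-refl
blocks-↭ key f [] (x ∷ xs) u has-key with has-key (here refl)
... | ()
blocks-↭ key f (k ∷ ks) xs (k-new ∷ u) has-key =
  ↭-trans (Permₚ.++⁺ˡ (filterᵇ inBlock xs) (subst (_↭ others) (sym later-blocks) rest))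
          (filter-partition-↭ inBlock xs)
  where
  inBlock = λ x → f x == key k
  others = filterᵇ (not ∘ inBlock) xs
  rest : concatMap (λ k′ → filterᵇ (λ x → f x == key k′) others) ks ↭ others
  rest = blocks-↭ key f ks others u λ m → other-key (filter-∈⁻ (not ∘ inBlock) xs m)
    where
    other-key : ∀ {x} → x ∈ xs × not (inBlock x) ≡ true → f x ∈ map key ks
    other-key (mx , e) with has-key mx
    ... | here fx≡k rewrite fx≡k | ==-refl (key k) with e
    ... | ()
    other-key (mx , e) | there m = m
  -- the later blocks do not meet the block of k
  later-blocks : concatMap (λ k′ → filterᵇ (λ x → f x == key k′) xs) ks
               ≡ concatMap (λ k′ → filterᵇ (λ x → f x == key k′) others) ks
  later-blocks = cong Data.List.concat (Listₚ.map-cong-local (All.tabulate λ {k′} mk′ →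
    sym (trans (filter-filter _ _ xs) (filter-cong _ _ xs λ {x} _ → not-in-block k′ mk′ x))))
    where
    not-in-block : ∀ k′ → k′ ∈ ks → ∀ x → (not (inBlock x) ∧ (f x == key k′)) ≡ (f x == key k′)
    not-in-block k′ mk′ x with f x == key k′ in e₁
    ... | false = ∧-zeroʳ (not (inBlock x))
    ... | true with inBlock x in e₂
    ... | false = refl
    ... | true = ⊥-elim (All.lookup k-new (∈-map⁺ key mk′) (trans (sym (==⇒≡ e₂)) (==⇒≡ e₁)))

Unique-map⁺ : ∀ (f : A → B) {xs} → (∀ {x y} → x ∈ xs → y ∈ xs → f x ≡ f y → x ≡ y) → Unique xs → Unique (map f xs)
Unique-map⁺ f {[]} inj [] = []
Unique-map⁺ f {x ∷ xs} inj (x∉ ∷ u) =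
  Allₚ.map⁺ (All.tabulate λ my e → All.lookup x∉ my (inj (here refl) (there my) e))
  ∷ Unique-map⁺ f (λ mx my → inj (there mx) (there my)) u

module StrictlySorted {_≺_ : Rel A 0ℓ} (≺-trans : Transitive _≺_) where

  sorted⇒allPairs : ∀ {xs} → Linked _≺_ xs → AllPairs _≺_ xs
  sorted⇒allPairs = Linkedₚ.Linked⇒AllPairs ≺-trans

  head-below : ∀ {x xs} → Linked _≺_ (x ∷ xs) → All (x ≺_) xs
  head-below l with sorted⇒allPairs l
  ... | below ∷ _ = below

  same-key⇒≡ : (K : A → A → Set) → (∀ {x y} → K x y → ¬ x ≺ y) → (∀ {x y} → K x y → K y x) →
    ∀ {xs x y} → Linked _≺_ xs → x ∈ xs → y ∈ xs → K x y → x ≡ y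
  same-key⇒≡ K K⇒⊀ K-sym l (here refl) (here refl) k = refl
  same-key⇒≡ K K⇒⊀ K-sym l (here refl) (there m) k = ⊥-elim (K⇒⊀ k (All.lookup (head-below l) m))
  same-key⇒≡ K K⇒⊀ K-sym l (there m) (here refl) k = ⊥-elim (K⇒⊀ (K-sym k) (All.lookup (head-below l) m))
  same-key⇒≡ K K⇒⊀ K-sym l (there m) (there m′) k = same-key⇒≡ K K⇒⊀ K-sym (Linked.tail l) m m′ k

  private
    behead : (∀ {x} → ¬ x ≺ x) → ∀ {x zs ws} → Linked _≺_ (x ∷ zs) →
      (∀ {z} → z ∈ x ∷ zs → z ∈ x ∷ ws) → ∀ {z} → z ∈ zs → z ∈ ws
    behead irr l h m with h (there m)
    ... | here refl = ⊥-elim (irr (All.lookup (head-below l) m))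
    ... | there m′ = m′

  sorted-ext : (∀ {x} → ¬ x ≺ x) → ∀ {xs ys} → Linked _≺_ xs → Linked _≺_ ys →
    (∀ {z} → z ∈ xs → z ∈ ys) → (∀ {z} → z ∈ ys → z ∈ xs) → xs ≡ ys
  sorted-ext irr {[]} {[]} _ _ f g = refl
  sorted-ext irr {[]} {y ∷ ys} _ _ f g with g (here refl)
  ... | ()
  sorted-ext irr {x ∷ xs} {[]} _ _ f g with f (here refl)
  ... | ()
  sorted-ext irr {x ∷ xs} {y ∷ ys} lx ly f g with f (here refl) | g (here refl)
  ... | there x∈ys | there y∈xs =
    ⊥-elim (irr (≺-trans (All.lookup (head-below lx) y∈xs) (All.lookup (head-below ly) x∈ys)))
  ... | here refl | _ =
    cong (x ∷_) (sorted-ext irr (Linked.tail lx) (Linked.tail ly) (behead irr lx f) (behead irr ly g))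
  ... | there _ | here refl =
    cong (x ∷_) (sorted-ext irr (Linked.tail lx) (Linked.tail ly) (behead irr lx f) (behead irr ly g))

  sorted⇒unique : (∀ {x} → ¬ x ≺ x) → ∀ {xs} → Linked _≺_ xs → Unique xs
  sorted⇒unique irr l = AllPairs.map (λ { x≺y refl → irr x≺y }) (sorted⇒allPairs l)

  sorted-filter : ∀ (p : A → Bool) {xs} → Linked _≺_ xs → Linked _≺_ (filterᵇ p xs)
  sorted-filter p = Linkedₚ.filter⁺ (T? ∘ p) ≺-trans

  module Merge {_≤_ : Rel A 0ℓ} (_≤?_ : Decidable _≤_)
               (≺⇒≤ : ∀ {x y} → x ≺ y → x ≤ y) (≤⇒⊁ : ∀ {x y} → x ≤ y → ¬ y ≺ x) where

    Comparable : List A → List A → Set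
    Comparable xs ys = All (λ x → All (λ y → x ≺ y ⊎ y ≺ x) ys) xs

    private
      merge-all : ∀ {P : A → Set} xs ys → All P xs → All P ys → All P (merge _≤?_ xs ys)
      merge-all xs ys a b = Permₚ.All-resp-↭ (↭-sym (Permₚ.merge-↭ _≤?_ xs ys)) (Allₚ.++⁺ a b)

      merge-allPairs : ∀ xs ys → AllPairs _≺_ xs → AllPairs _≺_ ys → Comparable xs ys →
        AllPairs _≺_ (merge _≤?_ xs ys)
      merge-allPairs [] ys _ b _ = b
      merge-allPairs (x ∷ xs) [] a _ _ = a
      merge-allPairs (x ∷ xs) (y ∷ ys) (ax ∷ a) (ay ∷ b) (cx ∷ c)
        with x ≤? y | All.lookup cx (here refl)
           | merge-allPairs xs (y ∷ ys) a (ay ∷ b) c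
           | merge-allPairs (x ∷ xs) ys (ax ∷ a) b (All.tail cx ∷ All.map All.tail c)
      ... | yes x≤y | inj₁ x≺y | sorted-rest | _ =
        merge-all xs (y ∷ ys) ax (x≺y ∷ All.map (≺-trans x≺y) ay) ∷ sorted-rest
      ... | yes x≤y | inj₂ y≺x | _ | _ = ⊥-elim (≤⇒⊁ x≤y y≺x)
      ... | no x≰y | inj₁ x≺y | _ | _ = ⊥-elim (x≰y (≺⇒≤ x≺y))
      ... | no x≰y | inj₂ y≺x | _ | sorted-rest =
        merge-all (x ∷ xs) ys (y≺x ∷ All.map (≺-trans y≺x) ax) ay ∷ sorted-rest

    merge-sorted : ∀ {xs ys} → Linked _≺_ xs → Linked _≺_ ys → Comparable xs ys → Linked _≺_ (merge _≤?_ xs ys)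
    merge-sorted {xs} {ys} a b c =
      Linkedₚ.AllPairs⇒Linked (merge-allPairs xs ys (sorted⇒allPairs a) (sorted⇒allPairs b) c)

_<lab_ : Rel (ℤ × RC) 0ℓ
a <lab b = proj₁ a < proj₁ b

<lab-trans : Transitive _<lab_
<lab-trans = ℤₚ.<-trans

<lab-irrefl : ∀ {x} → ¬ (x <lab x)
<lab-irrefl = ℤₚ.<-irrefl refl

<cell-trans : Transitive _<cell_
<cell-trans (inj₁ a) (inj₁ b) = inj₁ (ℤₚ.<-trans a b)
<cell-trans (inj₁ a) (inj₂ (refl , b)) = inj₁ a
<cell-trans (inj₂ (refl , a)) (inj₁ b) = inj₁ b
<cell-trans (inj₂ (refl , a)) (inj₂ (refl , b)) = inj₂ (refl , ℤₚ.<-trans a b)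

<cell-irrefl : ∀ {x} → ¬ (x <cell x)
<cell-irrefl (inj₁ a) = ℤₚ.<-irrefl refl a
<cell-irrefl (inj₂ (_ , a)) = ℤₚ.<-irrefl refl a

<cell⇒≤cell : ∀ {x y} → x <cell y → T (cellLeqᵇ x y)
<cell⇒≤cell {i , j , _} {i′ , j′ , _} (inj₁ i<i′) =
  Equivalence.from (T-∨ {⌊ i ℤ.<? i′ ⌋}) (inj₁ (fromWitness i<i′))
<cell⇒≤cell {i , j , _} {i′ , j′ , _} (inj₂ (refl , j<j′)) =
  Equivalence.from (T-∨ {⌊ i ℤ.<? i ⌋}) (inj₂ (Equivalence.from (T-∧ {i == i})
    (fromWitness {a? = i ℤ.≟ i} refl , fromWitness {a? = j ℤ.≤? j′} (ℤₚ.<⇒≤ j<j′))))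

≤cell⇒≯cell : ∀ {x y} → T (cellLeqᵇ x y) → ¬ (y <cell x)
≤cell⇒≯cell {i , j , _} {i′ , j′ , _} le y<x with Equivalence.to (T-∨ {⌊ i ℤ.<? i′ ⌋}) le | y<x
... | inj₁ i<i′ | inj₁ i′<i = ℤₚ.<-asym (toWitness i<i′) i′<i
... | inj₁ i<i′ | inj₂ (refl , _) = ℤₚ.<-irrefl refl (toWitness i<i′)
... | inj₂ i=i′∧j≤j′ | y<x′ with Equivalence.to (T-∧ {i == i′}) i=i′∧j≤j′
... | i=i′ , j≤j′ with toWitness {a? = i ℤ.≟ i′} i=i′ | y<x′
... | refl | inj₁ i<i = ℤₚ.<-irrefl refl i<i
... | refl | inj₂ (_ , j′<j) = ℤₚ.<⇒≱ j′<j (toWitness j≤j′)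

module IntOrder = StrictlySorted {_≺_ = _<_} ℤₚ.<-trans
module LabelOrder = StrictlySorted {_≺_ = _<lab_} (λ {x} {y} {z} → <lab-trans {x} {y} {z})
module CellOrder = StrictlySorted {_≺_ = _<cell_} (λ {x} {y} {z} → <cell-trans {x} {y} {z})
module MergeLabels = LabelOrder.Merge _≤lab?_ ℤₚ.<⇒≤ (λ x≤y y<x → ℤₚ.<⇒≱ y<x x≤y)
module MergeCells = CellOrder.Merge _≤cell?_ (λ {x} {y} → <cell⇒≤cell {x} {y}) (λ {x} {y} → ≤cell⇒≯cell {x} {y})

ArrowCells ArrowsLeftEmpty ArrowsUpEmpty : Tableau → Set
ArrowCells T = ∀ {i j a} → (i , j , a) ∈ arrows T → ((i , row) ∈ labels T) × ((j , col) ∈ labels T) × (i < j)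
ArrowsLeftEmpty T = ∀ {i j i′ j′ b} → (i , j , left) ∈ arrows T → (i′ , j′ , b) ∈ arrows T → i′ ≡ i → ¬ (j < j′)
ArrowsUpEmpty T = ∀ {i j i′ j′ b} → (i , j , up) ∈ arrows T → (i′ , j′ , b) ∈ arrows T → j′ ≡ j → ¬ (i′ < i)

mkAlternative : ∀ {T} → Linked _<lab_ (labels T) → Linked _<cell_ (arrows T) →
  ArrowCells T → ArrowsLeftEmpty T → ArrowsUpEmpty T → AlternativeTableau T
mkAlternative {T} sl sa cells leftE upE = mkAlt sl sa (All.tabulate cells)
  (All.tabulate λ m e → All.tabulate λ m′ → leftE (withArrow m e) m′)
  (All.tabulate λ m e → All.tabulate λ m′ → upE (withArrow m e) m′)
  where
  withArrow : ∀ {x a} → x ∈ arrows T → proj₂ (proj₂ x) ≡ a → (proj₁ x , proj₁ (proj₂ x) , a) ∈ arrows T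
  withArrow m refl = m

alternative-conditions : ∀ {T} → AlternativeTableau T →
  Linked _<lab_ (labels T) × Linked _<cell_ (arrows T) × ArrowCells T × ArrowsLeftEmpty T × ArrowsUpEmpty T
alternative-conditions (mkAlt sl sa cells leftE upE) =
  sl , sa , All.lookup cells , (λ m m′ → All.lookup (All.lookup leftE m refl) m′)
     , (λ m m′ → All.lookup (All.lookup upE m refl) m′)

module Alternative {T : Tableau} (alt : AlternativeTableau T) where

  private
    components = alternative-conditions alt

  labels-sorted : Linked _<lab_ (labels T)
  labels-sorted = proj₁ components

  arrows-sorted : Linked _<cell_ (arrows T)
  arrows-sorted = proj₁ (proj₂ components)

  arrow-cell : ArrowCells T
  arrow-cell = proj₁ (proj₂ (proj₂ components))

  left-empty : ArrowsLeftEmpty T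
  left-empty = proj₁ (proj₂ (proj₂ (proj₂ components)))

  up-empty : ArrowsUpEmpty T
  up-empty = proj₂ (proj₂ (proj₂ (proj₂ components)))

  label-unique : ∀ {x y} → x ∈ labels T → y ∈ labels T → proj₁ x ≡ proj₁ y → x ≡ y
  label-unique = LabelOrder.same-key⇒≡ (λ x y → proj₁ x ≡ proj₁ y) (λ { {x} refl → <lab-irrefl {x} }) sym labels-sorted

  row≢col : ∀ {l} → (l , row) ∈ labels T → (l , col) ∈ labels T → ⊥
  row≢col r c with label-unique r c refl
  ... | ()

  cell-unique : ∀ {i j a b} → (i , j , a) ∈ arrows T → (i , j , b) ∈ arrows T → a ≡ b
  cell-unique m m′ = cong (proj₂ ∘ proj₂)
    (CellOrder.same-key⇒≡ SameCell (λ { {x} (refl , refl) → <cell-irrefl {x} }) (λ { (refl , refl) → refl , refl })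
      arrows-sorted m m′ (refl , refl))
    where
    SameCell : (ℤ × ℤ × Arrow) → (ℤ × ℤ × Arrow) → Set
    SameCell (i , j , _) (i′ , j′ , _) = (i ≡ i′) × (j ≡ j′)

  ∈labelSet : ∀ {l κ} → (l , κ) ∈ labels T → l ∈ labelSet T
  ∈labelSet = ∈-map⁺ proj₁

  label-kind : ∀ {l} → l ∈ labelSet T → ((l , row) ∈ labels T) ⊎ ((l , col) ∈ labels T)
  label-kind m with ∈-map⁻ proj₁ m
  ... | (_ , row) , m′ , refl = inj₁ m′
  ... | (_ , col) , m′ , refl = inj₂ m′

  arrow-ends : ∀ {i j a} → (i , j , a) ∈ arrows T → (i ∈ᵇ labelSet T) ≡ true × (j ∈ᵇ labelSet T) ≡ true
  arrow-ends m = let r , c , _ = arrow-cell m in ∈⇒∈ᵇ _ (∈labelSet r) , ∈⇒∈ᵇ _ (∈labelSet c)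

  ownArrows≡arrows : ownArrows T ≡ arrows T
  ownArrows≡arrows = filter-all _ (arrows T) λ m → let a , b = arrow-ends m in ∧-true⁺ a b

labelSet-unique : ∀ {T} → AlternativeTableau T → Unique (labelSet T)
labelSet-unique alt = IntOrder.sorted⇒unique (ℤₚ.<-irrefl refl) (Linkedₚ.map⁺ (Alternative.labels-sorted alt))

restrictBy : Tableau → (ℤ → Bool) → Tableau
restrictBy T q = tab (filterᵇ (q ∘ proj₁) (labels T))
                     (filterᵇ (λ a → q (proj₁ a) ∧ q (proj₁ (proj₂ a))) (arrows T))

module Restriction {T : Tableau} (alt : AlternativeTableau T) (q : ℤ → Bool) where
  open Alternative alt

  restrict≡restrictBy : restrict T (filterᵇ q (labelSet T)) ≡ restrictBy T q
  restrict≡restrictBy = cong₂ tab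
    (filter-cong _ _ (labels T) λ {x} m →
      trans (∈ᵇ-filter q (proj₁ x) (labelSet T)) (cong (_∧ q (proj₁ x)) (∈⇒∈ᵇ _ (∈labelSet m))))
    (filter-cong _ _ (arrows T) λ {x} m →
      let e₁ , e₂ = arrow-ends m in
      cong₂ _∧_ (trans (∈ᵇ-filter q (proj₁ x) (labelSet T)) (cong (_∧ q (proj₁ x)) e₁))
                (trans (∈ᵇ-filter q (proj₁ (proj₂ x)) (labelSet T)) (cong (_∧ q (proj₁ (proj₂ x))) e₂)))

  restrictBy-alt : AlternativeTableau (restrictBy T q)
  restrictBy-alt = mkAlternative
    (LabelOrder.sorted-filter _ labels-sorted) (CellOrder.sorted-filter _ arrows-sorted)
    cells (λ m m′ → left-empty (from m) (from m′)) (λ m m′ → up-empty (from m) (from m′))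
    where
    inside = λ (a : ℤ × ℤ × Arrow) → q (proj₁ a) ∧ q (proj₁ (proj₂ a))
    from : ∀ {a} → a ∈ arrows (restrictBy T q) → a ∈ arrows T
    from m = proj₁ (filter-∈⁻ inside (arrows T) m)
    cells : ArrowCells (restrictBy T q)
    cells m = let m′ , e = filter-∈⁻ inside (arrows T) m
                  qi , qj = ∧-true⁻ e
                  r , c , i<j = arrow-cell m′
              in filter-∈⁺ _ (labels T) r qi , filter-∈⁺ _ (labels T) c qj , i<j

-- In an alternative tableau every label has at most one
-- successor: a row the column of its left arrow, a column the row of its
-- up arrow.  Following successors from a row goes to a column and then to
-- a strictly higher row, so every walk stops, at a label without
-- successor, i.e. a free row or free column: its root.

successor : List (ℤ × ℤ × Arrow) → ℤ → Maybe ℤ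
successor [] l = nothing
successor ((i , j , left) ∷ as) l = if i == l then just j else successor as l
successor ((i , j , up) ∷ as) l = if j == l then just i else successor as l

Terminal : List (ℤ × ℤ × Arrow) → ℤ → Set
Terminal as l = successor as l ≡ nothing

successor-arrow : ∀ as l {m} → successor as l ≡ just m → ((l , m , left) ∈ as) ⊎ ((m , l , up) ∈ as)
successor-arrow ((i , j , left) ∷ as) l e with i == l in i=l
... | true with e
... | refl rewrite ==⇒≡ {i} {l} i=l = inj₁ (here refl)
successor-arrow ((i , j , left) ∷ as) l e | false with successor-arrow as l e
... | inj₁ m = inj₁ (there m)
... | inj₂ m = inj₂ (there m)
successor-arrow ((i , j , up) ∷ as) l e with j == l in j=l
... | true with e
... | refl rewrite ==⇒≡ {j} {l} j=l = inj₂ (here refl)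
successor-arrow ((i , j , up) ∷ as) l e | false with successor-arrow as l e
... | inj₁ m = inj₁ (there m)
... | inj₂ m = inj₂ (there m)

terminal-no-left : ∀ as l {m} → Terminal as l → ¬ ((l , m , left) ∈ as)
terminal-no-left ((i , j , left) ∷ as) l t (here refl) rewrite ==-refl l with t
... | ()
terminal-no-left ((i , j , left) ∷ as) l t (there m) with i == l
... | false = terminal-no-left as l t m
terminal-no-left ((i , j , up) ∷ as) l t (there m) with j == l
... | false = terminal-no-left as l t m

terminal-no-up : ∀ as l {m} → Terminal as l → ¬ ((m , l , up) ∈ as)
terminal-no-up ((i , j , up) ∷ as) l t (here refl) rewrite ==-refl l with t
... | ()
terminal-no-up ((i , j , left) ∷ as) l t (there m) with i == l
... | false = terminal-no-up as l t m
terminal-no-up ((i , j , up) ∷ as) l t (there m) with j == l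
... | false = terminal-no-up as l t m

walk : List (ℤ × ℤ × Arrow) → ℕ → ℤ → ℤ
walk as zero l = l
walk as (suc n) l = maybe′ (walk as n) l (successor as l)

walk-stable : ∀ as n l → Terminal as (walk as n l) → walk as (suc n) l ≡ walk as n l
walk-stable as zero l t rewrite t = refl
walk-stable as (suc n) l t with successor as l
... | nothing = refl
... | just m = walk-stable as n m t

walk-terminal : ∀ as n l → Terminal as l → walk as n l ≡ l
walk-terminal as zero l t = refl
walk-terminal as (suc n) l t rewrite t = refl

ClosedUnder : List (ℤ × ℤ × Arrow) → List ℤ → Set
ClosedUnder as X = ∀ {i j a} → (i , j , a) ∈ as → (i ∈ᵇ X) ≡ (j ∈ᵇ X)

walk-closed : ∀ as X → ClosedUnder as X → ∀ n l → (l ∈ᵇ X) ≡ (walk as n l ∈ᵇ X)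
walk-closed as X closed zero l = refl
walk-closed as X closed (suc n) l with successor as l in e
... | nothing = refl
... | just m with successor-arrow as l e
... | inj₁ a = trans (closed a) (walk-closed as X closed n m)
... | inj₂ a = trans (sym (closed a)) (walk-closed as X closed n m)

rank : List ℤ → ℤ → ℕ
rank L l = length (filterᵇ (λ m → ⌊ m ℤ.<? l ⌋) L)

rank-mono : ∀ L {a b} → a ∈ L → a < b → rank L a ℕ.< rank L b
rank-mono L {a} {b} a∈L a<b = length-filter-strict _ _ L
  (λ {x} _ x<a → <ᵇ-true (ℤₚ.<-trans (<ᵇ-true⁻ {x} x<a) a<b)) a∈L (<ᵇ-false (ℤₚ.<-irrefl refl)) (<ᵇ-true a<b)
  where
  <ᵇ-true : ∀ {x y} → x < y → ⌊ x ℤ.<? y ⌋ ≡ true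
  <ᵇ-true {x} {y} p = trans (isYes≗does (x ℤ.<? y)) (dec-true (x ℤ.<? y) p)
  <ᵇ-false : ∀ {x y} → ¬ x < y → ⌊ x ℤ.<? y ⌋ ≡ false
  <ᵇ-false {x} {y} p = trans (isYes≗does (x ℤ.<? y)) (dec-false (x ℤ.<? y) p)
  <ᵇ-true⁻ : ∀ {x y} → ⌊ x ℤ.<? y ⌋ ≡ true → x < y
  <ᵇ-true⁻ e = toWitness (Equivalence.from T-≡ e)

rank-bound : ∀ L l → rank L l ℕ.< suc (length L)
rank-bound L l = ℕ.s≤s (Listₚ.length-filter (T? ∘ _) L)

module Roots {T : Tableau} (alt : AlternativeTableau T) where
  open Alternative alt

  private
    As = arrows T

  left⇒successor : ∀ {i j} → (i , j , left) ∈ As → successor As i ≡ just j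
  left⇒successor {i} {j} m with successor As i in e
  ... | nothing = ⊥-elim (terminal-no-left As i e m)
  ... | just j′ with successor-arrow As i e
  ... | inj₂ m′ = ⊥-elim (row≢col (proj₁ (arrow-cell m)) (proj₁ (proj₂ (arrow-cell m′))))
  ... | inj₁ m′ with ℤₚ.<-cmp j j′
  ... | tri< j<j′ _ _ = ⊥-elim (left-empty m m′ refl j<j′)
  ... | tri≈ _ refl _ = refl
  ... | tri> _ _ j′<j = ⊥-elim (left-empty m′ m refl j′<j)

  up⇒successor : ∀ {i j} → (i , j , up) ∈ As → successor As j ≡ just i
  up⇒successor {i} {j} m with successor As j in e
  ... | nothing = ⊥-elim (terminal-no-up As j e m)
  ... | just i′ with successor-arrow As j e
  ... | inj₁ m′ = ⊥-elim (row≢col (proj₁ (arrow-cell m′)) (proj₁ (proj₂ (arrow-cell m))))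
  ... | inj₂ m′ with ℤₚ.<-cmp i i′
  ... | tri< i<i′ _ _ = ⊥-elim (up-empty m′ m refl i<i′)
  ... | tri≈ _ refl _ = refl
  ... | tri> _ _ i′<i = ⊥-elim (up-empty m m′ refl i′<i)

  left-then-up : ∀ {i j i′} → (i , j , left) ∈ As → (i′ , j , up) ∈ As → i′ < i
  left-then-up {i} {j} {i′} ml mu with ℤₚ.<-cmp i′ i
  ... | tri< i′<i _ _ = i′<i
  ... | tri≈ _ refl _ with cell-unique ml mu
  ... | ()
  left-then-up ml mu | tri> _ _ i<i′ = ⊥-elim (up-empty mu ml refl i<i′)

  successor-label : ∀ {l m} → successor As l ≡ just m → m ∈ labelSet T
  successor-label {l} e with successor-arrow As l e
  ... | inj₁ a = ∈labelSet (proj₁ (proj₂ (arrow-cell a)))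
  ... | inj₂ a = ∈labelSet (proj₁ (arrow-cell a))

  walk-label : ∀ n {l} → l ∈ labelSet T → walk As n l ∈ labelSet T
  walk-label zero m = m
  walk-label (suc n) {l} m with successor As l in e
  ... | nothing = m
  ... | just x = walk-label n (successor-label e)

  row-walk-terminates : ∀ n i → (i , row) ∈ labels T → rank (labelSet T) i ℕ.< n →
    Terminal As (walk As (n * 2) i)
  row-walk-terminates (suc n) i mi r with successor As i in e
  ... | nothing = e
  ... | just j with successor-arrow As i e
  ... | inj₂ a = ⊥-elim (row≢col mi (proj₁ (proj₂ (arrow-cell a))))
  ... | inj₁ a with successor As j in e₂
  ... | nothing = e₂
  ... | just i′ with successor-arrow As j e₂
  ... | inj₁ b = ⊥-elim (row≢col (proj₁ (arrow-cell b)) (proj₁ (proj₂ (arrow-cell a))))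
  ... | inj₂ b = row-walk-terminates n i′ (proj₁ (arrow-cell b))
    (ℕₚ.<-≤-trans (rank-mono (labelSet T) (∈labelSet (proj₁ (arrow-cell b))) (left-then-up a b)) (ℕₚ.≤-pred r))

  -- Every walk terminates within `fuel` steps: a column takes one step to
  -- a row, a row at most 2 · (number of labels) steps.
  private
    fuel : ℕ
    fuel = suc (length (labelSet T)) * 2

    terminal-after-fuel : ∀ {l} → l ∈ labelSet T → Terminal As (walk As (suc fuel) l)
    terminal-after-fuel {l} m with label-kind m
    ... | inj₁ r = subst (Terminal As) (sym (walk-stable As fuel l t)) t
      where t = row-walk-terminates (suc (length (labelSet T))) l r (rank-bound (labelSet T) l)
    ... | inj₂ c with successor As l in e
    ... | nothing = e
    ... | just i with successor-arrow As l e
    ... | inj₁ a = ⊥-elim (row≢col (proj₁ (arrow-cell a)) c)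
    ... | inj₂ a = row-walk-terminates (suc (length (labelSet T))) i (proj₁ (arrow-cell a)) (rank-bound (labelSet T) i)

  root : ℤ → ℤ
  root = walk As (suc (suc fuel))

  private
    root-unfold : ∀ {l} → l ∈ labelSet T → root l ≡ walk As (suc fuel) l
    root-unfold m = walk-stable As (suc fuel) _ (terminal-after-fuel m)

  root-terminal : ∀ {l} → l ∈ labelSet T → Terminal As (root l)
  root-terminal m = subst (Terminal As) (sym (root-unfold m)) (terminal-after-fuel m)

  root-label : ∀ {l} → l ∈ labelSet T → root l ∈ labelSet T
  root-label = walk-label (suc (suc fuel))

  root-of-terminal : ∀ {l} → Terminal As l → root l ≡ l
  root-of-terminal = walk-terminal As (suc (suc fuel)) _

  root-arrow : ∀ {i j a} → (i , j , a) ∈ As → root i ≡ root j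
  root-arrow {i} {j} {left} m rewrite left⇒successor m = sym (root-unfold (∈labelSet (proj₁ (proj₂ (arrow-cell m)))))
  root-arrow {i} {j} {up} m rewrite up⇒successor m = root-unfold (∈labelSet (proj₁ (arrow-cell m)))

  root-closed : ∀ X → ClosedUnder As X → ∀ l → (l ∈ᵇ X) ≡ (root l ∈ᵇ X)
  root-closed X closed = walk-closed As X closed (suc (suc fuel))

freeRowᵇ freeColᵇ freeᵇ : Tableau → ℤ × RC → Bool
freeRowᵇ T x = isRowᵇ (proj₂ x) ∧ isFreeRowᵇ T (proj₁ x)
freeColᵇ T x = isColᵇ (proj₂ x) ∧ isFreeColᵇ T (proj₁ x)
freeᵇ T x = freeRowᵇ T x ∨ freeColᵇ T x

leftInRow upInCol : ℤ → (ℤ × ℤ × Arrow) → Bool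
leftInRow r a = (proj₁ a == r) ∧ isLeftᵇ (proj₂ (proj₂ a))
upInCol c a = (proj₁ (proj₂ a) == c) ∧ isUpᵇ (proj₂ (proj₂ a))

freeRow-freeCol-disjoint : ∀ T T′ x → (freeRowᵇ T x ∧ freeColᵇ T′ x) ≡ false
freeRow-freeCol-disjoint T T′ (l , row) = ∧-zeroʳ (isFreeRowᵇ T l)
freeRow-freeCol-disjoint T T′ (l , col) = refl

-- free labels are free rows or free columns, never both
length-Free : ∀ T → length (Free T) ≡ length (freeRows T) + length (freeCols T)
length-Free T = begin
  length (Free T)                                          ≡⟨ Listₚ.length-map proj₁ (filterᵇ (freeᵇ T) (labels T)) ⟩
  length (filterᵇ (freeᵇ T) (labels T))                    ≡⟨ length-filter-∨ (freeRowᵇ T) (freeColᵇ T) (labels T)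
                                                                (λ {x} _ → freeRow-freeCol-disjoint T T x) ⟩
  length (filterᵇ (freeRowᵇ T) (labels T)) + length (filterᵇ (freeColᵇ T) (labels T))
    ≡⟨ sym (cong₂ _+_ (Listₚ.length-map proj₁ (filterᵇ (freeRowᵇ T) (labels T)))
                      (Listₚ.length-map proj₁ (filterᵇ (freeColᵇ T) (labels T)))) ⟩
  length (freeRows T) + length (freeCols T)                ∎
  where open ≡-Reasoning

closedᵇ⇒ClosedUnder : ∀ T X → closedᵇ T X ≡ true → ClosedUnder (arrows T) X
closedᵇ⇒ClosedUnder T X e m = toWitness (Equivalence.from T-≡ (all-true⁻ _ (arrows T) e m))

ClosedUnder⇒closedᵇ : ∀ T X → ClosedUnder (arrows T) X → closedᵇ T X ≡ true
ClosedUnder⇒closedᵇ T X closed = all-true⁺ _ (arrows T) (λ m → Equivalence.to T-≡ (fromWitness (closed m)))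

filter∈subsets : ∀ (p : A → Bool) xs → filterᵇ p xs ∈ subsets xs
filter∈subsets p [] = here refl
filter∈subsets p (x ∷ xs) with p x
... | true = ∈-++⁺ˡ (∈-map⁺ (x ∷_) (filter∈subsets p xs))
... | false = ∈-++⁺ʳ (map (x ∷_) (subsets xs)) (filter∈subsets p xs)

module Component {T : Tableau} (alt : AlternativeTableau T) where
  open Alternative alt

  component≡ : ∀ (q : ℤ → Bool) {k} → k ∈ labelSet T → q k ≡ true →
    (∀ {i j a} → (i , j , a) ∈ arrows T → q i ≡ q j) →
    (∀ X → ClosedUnder (arrows T) X → (k ∈ᵇ X) ≡ true → ∀ {l} → q l ≡ true → (l ∈ᵇ X) ≡ true) →
    component T k ≡ filterᵇ q (labelSet T)
  component≡ q {k} k∈T qk q-closed q-least = filter-cong _ q (labelSet T) (λ {l} l∈T → in-all-candidates l∈T)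
    where
    candidate = λ X → (k ∈ᵇ X) ∧ closedᵇ T X
    candidates = filterᵇ candidate (subsets (labelSet T))
    Y = filterᵇ q (labelSet T)
    ∈ᵇY : ∀ l → (l ∈ᵇ Y) ≡ ((l ∈ᵇ labelSet T) ∧ q l)
    ∈ᵇY l = ∈ᵇ-filter q l (labelSet T)
    Y-candidate : Y ∈ candidates
    Y-candidate = filter-∈⁺ candidate _ (filter∈subsets q (labelSet T)) (∧-true⁺
      (trans (∈ᵇY k) (∧-true⁺ (∈⇒∈ᵇ _ k∈T) qk))
      (ClosedUnder⇒closedᵇ T Y λ m → let e₁ , e₂ = arrow-ends m in
        trans (∈ᵇY _) (trans (cong₂ _∧_ (trans e₁ (sym e₂)) (q-closed m)) (sym (∈ᵇY _)))))
    in-all-candidates : ∀ {l} → l ∈ labelSet T → all (λ X → l ∈ᵇ X) candidates ≡ q l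
    in-all-candidates {l} l∈T with q l in ql
    ... | true = all-true⁺ _ candidates λ {X} mX →
      let kX , closedX = ∧-true⁻ (proj₂ (filter-∈⁻ candidate (subsets (labelSet T)) mX))
      in q-least X (closedᵇ⇒ClosedUnder T X closedX) kX ql
    ... | false = all-false⁺ _ candidates Y-candidate
      (trans (∈ᵇY l) (trans (cong ((l ∈ᵇ labelSet T) ∧_) ql) (∧-zeroʳ _)))

module Freeness {T : Tableau} (alt : AlternativeTableau T) where
  open Alternative alt
  open Roots alt

  private
    terminal-no-leftInRow : ∀ {l} → Terminal (arrows T) l → ∀ {a} → a ∈ arrows T → leftInRow l a ≡ false
    terminal-no-leftInRow {l} t {i , j , left} m with i == l in e
    ... | true rewrite ==⇒≡ {i} {l} e = ⊥-elim (terminal-no-left (arrows T) l t m)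
    ... | false = refl
    terminal-no-leftInRow {l} t {i , j , up} m = ∧-zeroʳ (i == l)

    terminal-no-upInCol : ∀ {l} → Terminal (arrows T) l → ∀ {a} → a ∈ arrows T → upInCol l a ≡ false
    terminal-no-upInCol {l} t {i , j , up} m with j == l in e
    ... | true rewrite ==⇒≡ {j} {l} e = ⊥-elim (terminal-no-up (arrows T) l t m)
    ... | false = refl
    terminal-no-upInCol {l} t {i , j , left} m = ∧-zeroʳ (j == l)

  terminal⇒free : ∀ {l κ} → Terminal (arrows T) l → (l , κ) ∈ labels T → freeᵇ T (l , κ) ≡ true
  terminal⇒free {l} {row} t _ rewrite any-false⁺ (leftInRow l) (arrows T) (terminal-no-leftInRow t) = refl
  terminal⇒free {l} {col} t _ rewrite any-false⁺ (upInCol l) (arrows T) (terminal-no-upInCol t) = refl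

  free⇒terminal : ∀ {l κ} → (l , κ) ∈ labels T → freeᵇ T (l , κ) ≡ true → Terminal (arrows T) l
  free⇒terminal {l} m free with successor (arrows T) l in e
  ... | nothing = refl
  ... | just x with successor-arrow (arrows T) l e
  ... | inj₁ a with label-unique m (proj₁ (arrow-cell a)) refl
  ... | refl rewrite any-true⁺ (leftInRow l) (arrows T) a (cong (_∧ true) (==-refl l)) with free
  ... | ()
  free⇒terminal {l} m free | just x | inj₂ a with label-unique m (proj₁ (proj₂ (arrow-cell a))) refl
  ... | refl rewrite any-true⁺ (upInCol l) (arrows T) a (cong (_∧ true) (==-refl l)) with free
  ... | ()

  root-free : ∀ {l} → l ∈ labelSet T → ∃[ κ ] ((root l , κ) ∈ labels T × freeᵇ T (root l , κ) ≡ true)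
  root-free m with label-kind (root-label m)
  ... | inj₁ r = row , r , terminal⇒free (root-terminal m) r
  ... | inj₂ c = col , c , terminal⇒free (root-terminal m) c

-- Restricting to an arrow-closed set of labels keeps every arrow touching
-- it, hence keeps the free rows and columns inside it.
module ClosedRestriction {T : Tableau} (q : ℤ → Bool) (q-closed : ∀ {i j a} → (i , j , a) ∈ arrows T → q i ≡ q j) where

  private
    inside = λ (a : ℤ × ℤ × Arrow) → q (proj₁ a) ∧ q (proj₁ (proj₂ a))

  freeRow-restrictBy : ∀ r → q r ≡ true → isFreeRowᵇ (restrictBy T q) r ≡ isFreeRowᵇ T r
  freeRow-restrictBy r qr = cong not (any-filter (leftInRow r) inside (arrows T) keeps)
    where
    keeps : ∀ {a} → a ∈ arrows T → leftInRow r a ≡ true → inside a ≡ true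
    keeps {i , j , a} m e with ==⇒≡ {i} {r} (proj₁ (∧-true⁻ e))
    ... | refl = ∧-true⁺ qr (trans (sym (q-closed m)) qr)

  freeCol-restrictBy : ∀ c → q c ≡ true → isFreeColᵇ (restrictBy T q) c ≡ isFreeColᵇ T c
  freeCol-restrictBy c qc = cong not (any-filter (upInCol c) inside (arrows T) keeps)
    where
    keeps : ∀ {a} → a ∈ arrows T → upInCol c a ≡ true → inside a ≡ true
    keeps {i , j , a} m e with ==⇒≡ {j} {c} (proj₁ (∧-true⁻ e))
    ... | refl = ∧-true⁺ (trans (q-closed m) qc) qc

  freeRows-restrictBy : filterᵇ (freeRowᵇ (restrictBy T q)) (labels (restrictBy T q))
                        ≡ filterᵇ (λ x → q (proj₁ x) ∧ freeRowᵇ T x) (labels T)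
  freeRows-restrictBy = trans (filter-filter _ _ (labels T)) (filter-cong _ _ (labels T) λ {x} _ → pointwise x)
    where
    pointwise : ∀ x → (q (proj₁ x) ∧ freeRowᵇ (restrictBy T q) x) ≡ (q (proj₁ x) ∧ freeRowᵇ T x)
    pointwise x with q (proj₁ x) in e
    ... | true = cong (isRowᵇ (proj₂ x) ∧_) (freeRow-restrictBy (proj₁ x) e)
    ... | false = refl

  freeCols-restrictBy : filterᵇ (freeColᵇ (restrictBy T q)) (labels (restrictBy T q))
                        ≡ filterᵇ (λ x → q (proj₁ x) ∧ freeColᵇ T x) (labels T)
  freeCols-restrictBy = trans (filter-filter _ _ (labels T)) (filter-cong _ _ (labels T) λ {x} _ → pointwise x)
    where
    pointwise : ∀ x → (q (proj₁ x) ∧ freeColᵇ (restrictBy T q) x) ≡ (q (proj₁ x) ∧ freeColᵇ T x)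
    pointwise x with q (proj₁ x) in e
    ... | true = cong (isColᵇ (proj₂ x) ∧_) (freeCol-restrictBy (proj₁ x) e)
    ... | false = refl

module Merge₂ {P Q : Tableau} (altP : AlternativeTableau P) (altQ : AlternativeTableau Q)
              (disjoint : ∀ {x y} → x ∈ labelSet P → y ∈ labelSet Q → x ≢ y) where

  private
    module AP = Alternative altP
    module AQ = Alternative altQ
    M = merge₂ P Q

    arrows≡ : arrows M ≡ merge _≤cell?_ (arrows P) (arrows Q)
    arrows≡ = cong₂ (merge _≤cell?_) AP.ownArrows≡arrows AQ.ownArrows≡arrows

  labels-↭ : labels M ↭ labels P ++ labels Q
  labels-↭ = Permₚ.merge-↭ _≤lab?_ (labels P) (labels Q)

  arrows-↭ : arrows M ↭ arrows P ++ arrows Q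
  arrows-↭ = subst (_↭ arrows P ++ arrows Q) (sym arrows≡) (Permₚ.merge-↭ _≤cell?_ (arrows P) (arrows Q))

  private
    arrow-part : ∀ {z} → z ∈ arrows M → z ∈ arrows P ⊎ z ∈ arrows Q
    arrow-part m = ∈-++⁻ (arrows P) (Permₚ.∈-resp-↭ arrows-↭ m)

    fromP : ∀ {z} → z ∈ labels P → z ∈ labels M
    fromP m = Permₚ.∈-resp-↭ (↭-sym labels-↭) (∈-++⁺ˡ m)

    fromQ : ∀ {z} → z ∈ labels Q → z ∈ labels M
    fromQ m = Permₚ.∈-resp-↭ (↭-sym labels-↭) (∈-++⁺ʳ (labels P) m)

    trichotomy : ∀ {a b : ℤ} → a ≢ b → a < b ⊎ b < a
    trichotomy {a} {b} a≢b with ℤₚ.<-cmp a b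
    ... | tri< a<b _ _ = inj₁ a<b
    ... | tri≈ _ a≡b _ = ⊥-elim (a≢b a≡b)
    ... | tri> _ _ b<a = inj₂ b<a

    row-disjoint : ∀ {i j a i′ j′ b} → (i , j , a) ∈ arrows P → (i′ , j′ , b) ∈ arrows Q → i ≢ i′
    row-disjoint mp mq = disjoint (AP.∈labelSet (proj₁ (AP.arrow-cell mp))) (AQ.∈labelSet (proj₁ (AQ.arrow-cell mq)))

    col-disjoint : ∀ {i j a i′ j′ b} → (i , j , a) ∈ arrows P → (i′ , j′ , b) ∈ arrows Q → j ≢ j′
    col-disjoint mp mq =
      disjoint (AP.∈labelSet (proj₁ (proj₂ (AP.arrow-cell mp)))) (AQ.∈labelSet (proj₁ (proj₂ (AQ.arrow-cell mq))))

  merge₂-alt : AlternativeTableau M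
  merge₂-alt = mkAlternative
    (MergeLabels.merge-sorted AP.labels-sorted AQ.labels-sorted
      (All.tabulate λ mx → All.tabulate λ my → trichotomy (disjoint (AP.∈labelSet mx) (AQ.∈labelSet my))))
    (subst (Linked _<cell_) (sym arrows≡) (MergeCells.merge-sorted AP.arrows-sorted AQ.arrows-sorted
      (All.tabulate λ mx → All.tabulate λ my → Sum.map inj₁ inj₁ (trichotomy (row-disjoint mx my)))))
    cells leftE upE
    where
    cells : ArrowCells M
    cells m with arrow-part m
    ... | inj₁ mp = let r , c , i<j = AP.arrow-cell mp in fromP r , fromP c , i<j
    ... | inj₂ mq = let r , c , i<j = AQ.arrow-cell mq in fromQ r , fromQ c , i<j
    leftE : ArrowsLeftEmpty M
    leftE m m′ e with arrow-part m | arrow-part m′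
    ... | inj₁ a | inj₁ b = AP.left-empty a b e
    ... | inj₂ a | inj₂ b = AQ.left-empty a b e
    ... | inj₁ a | inj₂ b = ⊥-elim (row-disjoint a b (sym e))
    ... | inj₂ a | inj₁ b = ⊥-elim (row-disjoint b a e)
    upE : ArrowsUpEmpty M
    upE m m′ e with arrow-part m | arrow-part m′
    ... | inj₁ a | inj₁ b = AP.up-empty a b e
    ... | inj₂ a | inj₂ b = AQ.up-empty a b e
    ... | inj₁ a | inj₂ b = ⊥-elim (col-disjoint a b (sym e))
    ... | inj₂ a | inj₁ b = ⊥-elim (col-disjoint b a e)

record Merged (S : List Tableau) : Set where
  field
    alternative : AlternativeTableau (mergeAll S)
    labels-↭ : labels (mergeAll S) ↭ concatMap labels S
    arrows-↭ : arrows (mergeAll S) ↭ concatMap arrows S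

mergeAll-merged : ∀ S → All AlternativeTableau S → Unique (concatMap labelSet S) → Merged S
mergeAll-merged [] _ _ = record { alternative = mkAlt [] [] [] [] [] ; labels-↭ = ↭-refl ; arrows-↭ = ↭-refl }
mergeAll-merged (P ∷ S) (altP ∷ altS) u = record
  { alternative = Merge₂.merge₂-alt altP (Merged.alternative rest) disjoint
  ; labels-↭ = ↭-trans (Merge₂.labels-↭ altP (Merged.alternative rest) disjoint)
                       (Permₚ.++⁺ˡ (labels P) (Merged.labels-↭ rest))
  ; arrows-↭ = ↭-trans (Merge₂.arrows-↭ altP (Merged.alternative rest) disjoint)
                       (Permₚ.++⁺ˡ (arrows P) (Merged.arrows-↭ rest))
  }
  where
  rest = mergeAll-merged S altS (Unique-++ʳ (labelSet P) u)
  disjoint : ∀ {x y} → x ∈ labelSet P → y ∈ labelSet (mergeAll S) → x ≢ y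
  disjoint {x} {y} mx my with ∈-map⁻ proj₁ my
  ... | z , mz , refl with ∈-concatMap⁻ labels S (Permₚ.∈-resp-↭ (Merged.labels-↭ rest) mz)
  ... | Q , mQ , zQ = Unique-++-disjoint {xs = labelSet P} u mx (∈-concatMap⁺ labelSet mQ (∈-map⁺ proj₁ zQ))

rowCount colCount : RC → ℕ
rowCount row = 1
rowCount col = 0
colCount row = 0
colCount col = 1

OfKind : Tableau → RC → Set
OfKind T κ = (length (freeRows T) ≡ rowCount κ) × (length (freeCols T) ≡ colCount κ)

packed-kind : ∀ {T} → Packed T → ∃[ κ ] OfKind T κ
packed-kind (_ , _ , inj₁ counts) = col , counts
packed-kind (_ , _ , inj₂ counts) = row , counts

kind-packed : ∀ {T} κ → AlternativeTableau T → 0 ℕ.< length (labels T) → OfKind T κ → Packed T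
kind-packed row alt nonempty counts = alt , nonempty , inj₂ counts
kind-packed col alt nonempty counts = alt , nonempty , inj₁ counts

oneRowNoColᵇ-kind : ∀ {T} κ → OfKind T κ → oneRowNoColᵇ T ≡ isRowᵇ κ
oneRowNoColᵇ-kind row (r , c) = cong₂ (λ n m → ⌊ n ℕ.≟ 1 ⌋ ∧ ⌊ m ℕ.≟ 0 ⌋) r c
oneRowNoColᵇ-kind col (r , c) = cong₂ (λ n m → ⌊ n ℕ.≟ 1 ⌋ ∧ ⌊ m ℕ.≟ 0 ⌋) r c

noRowOneColᵇ-kind : ∀ {T} κ → OfKind T κ → noRowOneColᵇ T ≡ isColᵇ κ
noRowOneColᵇ-kind row (r , c) = cong₂ (λ n m → ⌊ n ℕ.≟ 0 ⌋ ∧ ⌊ m ℕ.≟ 1 ⌋) r c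
noRowOneColᵇ-kind col (r , c) = cong₂ (λ n m → ⌊ n ℕ.≟ 0 ⌋ ∧ ⌊ m ℕ.≟ 1 ⌋) r c

packed-one-free : ∀ {T} → Packed T → length (Free T) ≡ 1
packed-one-free {T} packed with packed-kind packed
... | row , r , c = trans (length-Free T) (cong₂ _+_ r c)
... | col , r , c = trans (length-Free T) (cong₂ _+_ r c)

-- For a free
-- label k, T(k) is the set of labels whose root is k; so split T lists the
-- restrictions of T to the trees of the free labels.  Each piece has k as
-- its only free label, hence is packed of the kind of k; distinct free
-- labels give distinct pieces; the trees partition the labels; and
-- merging the pieces gives back T, as every arrow lies inside a tree.

module SplitOf {T : Tableau} (alt : AlternativeTableau T) where
  open Alternative alt
  open Roots alt
  open Freeness alt

  freeLabels : List (ℤ × RC)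
  freeLabels = filterᵇ (freeᵇ T) (labels T)

  inTree : ℤ → ℤ → Bool
  inTree k l = root l == k

  inTree-closed : ∀ k {i j a} → (i , j , a) ∈ arrows T → inTree k i ≡ inTree k j
  inTree-closed k m = cong (_== k) (root-arrow m)

  piece : ℤ × RC → Tableau
  piece w = restrictBy T (inTree (proj₁ w))

  pieces : List Tableau
  pieces = map piece freeLabels

  private
    free-label : ∀ {w} → w ∈ freeLabels → w ∈ labels T
    free-label m = proj₁ (filter-∈⁻ (freeᵇ T) (labels T) m)

    free-root : ∀ {w} → w ∈ freeLabels → root (proj₁ w) ≡ proj₁ w
    free-root m = let m′ , free = filter-∈⁻ (freeᵇ T) (labels T) m in root-of-terminal (free⇒terminal m′ free)

    in-own-tree : ∀ {w} → w ∈ freeLabels → inTree (proj₁ w) (proj₁ w) ≡ true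
    in-own-tree {w} m = trans (cong (_== proj₁ w) (free-root m)) (==-refl (proj₁ w))

  component-free : ∀ {w} → w ∈ freeLabels → component T (proj₁ w) ≡ filterᵇ (inTree (proj₁ w)) (labelSet T)
  component-free {w} m = Component.component≡ alt (inTree k) (∈labelSet (free-label m)) (in-own-tree m)
    (inTree-closed k) (λ X closed kX {l} e → trans (root-closed X closed l) (trans (cong (_∈ᵇ X) (==⇒≡ e)) kX))
    where k = proj₁ w

  split≡pieces : split T ≡ pieces
  split≡pieces = trans (sym (Listₚ.map-∘ freeLabels)) (Listₚ.map-cong-local (All.tabulate λ m →
    trans (cong (restrict T) (component-free m)) (Restriction.restrict≡restrictBy alt _)))

  -- The free labels of the piece of w are those of T in the tree of w,
  -- that is, w alone.
  private
    only-w : ∀ {w} → w ∈ freeLabels → ∀ (p : ℤ × RC → Bool) → (∀ {x} → x ∈ labels T → p x ≡ true → freeᵇ T x ≡ true) →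
      filterᵇ (λ x → inTree (proj₁ w) (proj₁ x) ∧ p x) (labels T) ≡ filterᵇ p (w ∷ [])
    only-w {w} m p p⇒free = begin
      filterᵇ (λ x → inTree k (proj₁ x) ∧ p x) (labels T)  ≡⟨ filter-cong _ _ (labels T) same-test ⟩
      filterᵇ (λ x → (proj₁ x == k) ∧ p x) (labels T)      ≡⟨ sym (filter-filter p (λ x → proj₁ x == k) (labels T)) ⟩
      filterᵇ p (filterᵇ (λ x → proj₁ x == k) (labels T))   ≡⟨ cong (filterᵇ p) key-k ⟩
      filterᵇ p (w ∷ [])                                     ∎
      where
      open ≡-Reasoning
      k = proj₁ w
      same-test : ∀ {x} → x ∈ labels T → (inTree k (proj₁ x) ∧ p x) ≡ ((proj₁ x == k) ∧ p x)
      same-test {x} mx with p x in px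
      ... | true = cong (λ z → (z == k) ∧ true) (root-of-terminal (free⇒terminal mx (p⇒free mx px)))
      ... | false = trans (∧-zeroʳ _) (sym (∧-zeroʳ _))
      key-k : filterᵇ (λ x → proj₁ x == k) (labels T) ≡ w ∷ []
      key-k = LabelOrder.sorted-ext (λ {x} → <lab-irrefl {x}) (LabelOrder.sorted-filter _ labels-sorted) [-]
        (λ mx → let mx′ , e = filter-∈⁻ _ (labels T) mx in here (label-unique mx′ (free-label m) (==⇒≡ e)))
        (λ { (here refl) → filter-∈⁺ _ (labels T) (free-label m) (==-refl k) })

    single-free-row : ∀ w → freeᵇ T w ≡ true → length (filterᵇ (freeRowᵇ T) (w ∷ [])) ≡ rowCount (proj₂ w)
    single-free-row (l , row) e rewrite trans (sym (∨-identityʳ (isFreeRowᵇ T l))) e = refl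
    single-free-row (l , col) _ = refl

    single-free-col : ∀ w → freeᵇ T w ≡ true → length (filterᵇ (freeColᵇ T) (w ∷ [])) ≡ colCount (proj₂ w)
    single-free-col (l , col) e rewrite e = refl
    single-free-col (l , row) _ = refl

    free-kind : ∀ {w} → w ∈ freeLabels → OfKind (piece w) (proj₂ w)
    free-kind {w} m =
        count (freeRowᵇ T) freeRows-restrictBy (λ {x} _ e → cong (_∨ freeColᵇ T x) e) (single-free-row w free-w)
      , count (freeColᵇ T) freeCols-restrictBy (λ {x} _ e → trans (cong (freeRowᵇ T x ∨_) e) (∨-zeroʳ _))
              (single-free-col w free-w)
      where
      open ClosedRestriction {T} (inTree (proj₁ w)) (inTree-closed (proj₁ w))
      free-w = proj₂ (filter-∈⁻ (freeᵇ T) (labels T) m)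
      count : ∀ p {n} {free-in-piece} → free-in-piece ≡ filterᵇ (λ x → inTree (proj₁ w) (proj₁ x) ∧ p x) (labels T) →
        (∀ {x} → x ∈ labels T → p x ≡ true → freeᵇ T x ≡ true) → length (filterᵇ p (w ∷ [])) ≡ n →
        length (map proj₁ free-in-piece) ≡ n
      count p {free-in-piece = F} restricted p⇒free n-w =
        trans (Listₚ.length-map proj₁ F) (trans (cong length (trans restricted (only-w m p p⇒free))) n-w)

  piece-packed : ∀ {w} → w ∈ freeLabels → Packed (piece w)
  piece-packed {w} m = kind-packed (proj₂ w) (Restriction.restrictBy-alt alt (inTree (proj₁ w))) nonempty (free-kind m)
    where
    nonempty : 0 ℕ.< length (labels (piece w))
    nonempty with filterᵇ (inTree (proj₁ w) ∘ proj₁) (labels T) | filter-∈⁺ (inTree (proj₁ w) ∘ proj₁) (labels T) (free-label m) (in-own-tree m)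
    ... | _ ∷ _ | _ = ℕ.s≤s ℕ.z≤n

  pieces-unique : Unique pieces
  pieces-unique = Unique-map⁺ piece injective (LabelOrder.sorted⇒unique (λ {x} → <lab-irrefl {x})
    (LabelOrder.sorted-filter (freeᵇ T) labels-sorted))
    where
    injective : ∀ {x y} → x ∈ freeLabels → y ∈ freeLabels → piece x ≡ piece y → x ≡ y
    injective {x} {y} mx my e =
      let x∈piece-x = filter-∈⁺ (inTree (proj₁ x) ∘ proj₁) (labels T) (free-label mx) (in-own-tree mx)
          _ , x∈tree-y = filter-∈⁻ (inTree (proj₁ y) ∘ proj₁) (labels T) (subst (λ P → x ∈ labels P) e x∈piece-x)
      in label-unique (free-label mx) (free-label my) (trans (sym (free-root mx)) (==⇒≡ x∈tree-y))

  pieces-length : length pieces ≡ length (freeRows T) + length (freeCols T)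
  pieces-length = trans (Listₚ.length-map piece freeLabels)
                        (trans (sym (Listₚ.length-map proj₁ freeLabels)) (length-Free T))

  private
    count-kind : ∀ (c : Tableau → Bool) (isKind : RC → Bool) (freeOfKind : ℤ × RC → Bool) →
      (∀ {w} → w ∈ freeLabels → c (piece w) ≡ isKind (proj₂ w)) →
      (∀ x → (freeᵇ T x ∧ isKind (proj₂ x)) ≡ freeOfKind x) →
      countᵇ c pieces ≡ length (map proj₁ (filterᵇ freeOfKind (labels T)))
    count-kind c isKind freeOfKind piece-kind kind-test = begin
      length (filterᵇ c (map piece freeLabels))                ≡⟨ cong length (sym (map-filter piece c freeLabels)) ⟩
      length (map piece (filterᵇ (c ∘ piece) freeLabels))      ≡⟨ Listₚ.length-map piece (filterᵇ (c ∘ piece) freeLabels) ⟩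
      length (filterᵇ (c ∘ piece) freeLabels)                  ≡⟨ cong length (filter-cong _ _ freeLabels piece-kind) ⟩
      length (filterᵇ (isKind ∘ proj₂) freeLabels)             ≡⟨ cong length (filter-filter _ _ (labels T)) ⟩
      length (filterᵇ (λ x → freeᵇ T x ∧ isKind (proj₂ x)) (labels T))
                                                               ≡⟨ cong length (filter-cong _ _ (labels T) (λ {x} _ → kind-test x)) ⟩
      length (filterᵇ freeOfKind (labels T))                   ≡⟨ sym (Listₚ.length-map proj₁ (filterᵇ freeOfKind (labels T))) ⟩
      length (map proj₁ (filterᵇ freeOfKind (labels T)))       ∎
      where open ≡-Reasoning

  pieces-rowKind : countᵇ oneRowNoColᵇ pieces ≡ length (freeRows T)
  pieces-rowKind = count-kind oneRowNoColᵇ isRowᵇ (freeRowᵇ T) (λ {w} m → oneRowNoColᵇ-kind {piece w} (proj₂ w) (free-kind m)) row-test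
    where
    row-test : ∀ x → (freeᵇ T x ∧ isRowᵇ (proj₂ x)) ≡ freeRowᵇ T x
    row-test (l , row) = trans (∧-identityʳ _) (∨-identityʳ (isFreeRowᵇ T l))
    row-test (l , col) = ∧-zeroʳ (isFreeColᵇ T l)

  pieces-colKind : countᵇ noRowOneColᵇ pieces ≡ length (freeCols T)
  pieces-colKind = count-kind noRowOneColᵇ isColᵇ (freeColᵇ T) (λ {w} m → noRowOneColᵇ-kind {piece w} (proj₂ w) (free-kind m)) col-test
    where
    col-test : ∀ x → (freeᵇ T x ∧ isColᵇ (proj₂ x)) ≡ freeColᵇ T x
    col-test (l , row) = ∧-zeroʳ (isFreeRowᵇ T l ∨ false)
    col-test (l , col) = ∧-identityʳ (isFreeColᵇ T l)

  pieces-partition : concatMap labelSet pieces ↭ labelSet T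
  pieces-partition = subst (_↭ labelSet T) (sym trees)
    (blocks-↭ proj₁ root freeLabels (labelSet T) free-keys-unique root-is-free)
    where
    trees : concatMap labelSet pieces ≡ concatMap (λ w → filterᵇ (λ l → root l == proj₁ w) (labelSet T)) freeLabels
    trees = trans (Listₚ.concatMap-map labelSet piece freeLabels)
                  (Listₚ.concatMap-cong (λ w → map-filter proj₁ (inTree (proj₁ w)) (labels T)) freeLabels)
    free-keys-unique : Unique (map proj₁ freeLabels)
    free-keys-unique = IntOrder.sorted⇒unique (ℤₚ.<-irrefl refl) (Linkedₚ.map⁺ (LabelOrder.sorted-filter (freeᵇ T) labels-sorted))
    root-is-free : ∀ {l} → l ∈ labelSet T → root l ∈ map proj₁ freeLabels
    root-is-free m = let κ , m′ , free = root-free m in ∈-map⁺ proj₁ (filter-∈⁺ (freeᵇ T) (labels T) m′ free)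

  merge-pieces : mergeAll pieces ≡ T
  merge-pieces = cong₂ tab
    (LabelOrder.sorted-ext (λ {x} → <lab-irrefl {x}) (Alternative.labels-sorted merged-alt) labels-sorted
      (λ m → let w , _ , m′ = from-pieces labels (Merged.labels-↭ merged) m in proj₁ (filter-∈⁻ _ (labels T) m′))
      (λ {z} m → to-pieces labels (Merged.labels-↭ merged) (root-piece (∈labelSet m)) (filter-∈⁺ _ (labels T) m (==-refl (root (proj₁ z))))))
    (CellOrder.sorted-ext (λ {x} → <cell-irrefl {x}) (Alternative.arrows-sorted merged-alt) arrows-sorted
      (λ m → let w , _ , m′ = from-pieces arrows (Merged.arrows-↭ merged) m in proj₁ (filter-∈⁻ _ (arrows T) m′))
      (λ {z} m → to-pieces arrows (Merged.arrows-↭ merged) (root-piece (∈labelSet (proj₁ (arrow-cell m))))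
         (filter-∈⁺ _ (arrows T) m (∧-true⁺ (==-refl (root (proj₁ z)))
           (trans (cong (_== root (proj₁ z)) (sym (root-arrow m))) (==-refl (root (proj₁ z))))))))
    where
    merged : Merged pieces
    merged = mergeAll-merged pieces (Allₚ.map⁺ (All.tabulate (proj₁ ∘ piece-packed)))
      (PermSₚ.Unique-resp-↭ (setoid ℤ) (↭⇒↭ₛ (↭-sym pieces-partition)) (labelSet-unique alt))
    merged-alt = Merged.alternative merged
    from-pieces : ∀ {X : Set} (part : Tableau → List X) {z} →
      part (mergeAll pieces) ↭ concatMap part pieces → z ∈ part (mergeAll pieces) → ∃[ w ] (w ∈ freeLabels × z ∈ part (piece w))
    from-pieces part perm m with ∈-concatMap⁻ part pieces (Permₚ.∈-resp-↭ perm m)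
    ... | P , mP , zP with ∈-map⁻ piece mP
    ... | w , mw , refl = w , mw , zP
    to-pieces : ∀ {X : Set} (part : Tableau → List X) {P z} →
      part (mergeAll pieces) ↭ concatMap part pieces → P ∈ pieces → z ∈ part P → z ∈ part (mergeAll pieces)
    to-pieces part perm mP m = Permₚ.∈-resp-↭ (↭-sym perm) (∈-concatMap⁺ part mP m)
    -- the piece containing l (a piece depends only on the label, not its tag)
    root-piece : ∀ {l} → l ∈ labelSet T → piece (root l , row) ∈ pieces
    root-piece m = let κ , m′ , free = root-free m in ∈-map⁺ piece (filter-∈⁺ (freeᵇ T) (labels T) m′ free)

-- Every label and arrow of M belongs to exactly one member, so a
-- label is free in M iff it is free in its member.  In a member P every
-- walk ends at the only free label k of P, so T(k) computed in M is the
-- label set of P, and M[k] = P: splitting M gives back S.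

module MergeOf {S : List Tableau} (packed : All Packed S) (disjoint : Unique (concatMap labelSet S)) where

  M : Tableau
  M = mergeAll S

  private
    merged : Merged S
    merged = mergeAll-merged S (All.map proj₁ packed) disjoint

    alt-member : ∀ {P} → P ∈ S → AlternativeTableau P
    alt-member m = proj₁ (All.lookup packed m)

  alt-M : AlternativeTableau M
  alt-M = Merged.alternative merged

  label-owner : ∀ {w} → w ∈ labels M → ∃[ P ] (P ∈ S × w ∈ labels P)
  label-owner m = ∈-concatMap⁻ labels S (Permₚ.∈-resp-↭ (Merged.labels-↭ merged) m)

  label-of-member : ∀ {P w} → P ∈ S → w ∈ labels P → w ∈ labels M
  label-of-member mP m = Permₚ.∈-resp-↭ (↭-sym (Merged.labels-↭ merged)) (∈-concatMap⁺ labels mP m)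

  arrow-owner : ∀ {a} → a ∈ arrows M → ∃[ P ] (P ∈ S × a ∈ arrows P)
  arrow-owner m = ∈-concatMap⁻ arrows S (Permₚ.∈-resp-↭ (Merged.arrows-↭ merged) m)

  arrow-of-member : ∀ {P a} → P ∈ S → a ∈ arrows P → a ∈ arrows M
  arrow-of-member mP m = Permₚ.∈-resp-↭ (↭-sym (Merged.arrows-↭ merged)) (∈-concatMap⁺ arrows mP m)

  same-member : ∀ {P Q l} → P ∈ S → Q ∈ S → l ∈ labelSet P → l ∈ labelSet Q → P ≡ Q
  same-member = shared-element⇒same-block labelSet S disjoint

  arrow-at-row : ∀ {P i j a} → P ∈ S → i ∈ labelSet P → (i , j , a) ∈ arrows M → (i , j , a) ∈ arrows P
  arrow-at-row mP iP m with arrow-owner m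
  ... | Q , mQ , aQ with same-member mP mQ iP (Alternative.∈labelSet (alt-member mQ) (proj₁ (Alternative.arrow-cell (alt-member mQ) aQ)))
  ... | refl = aQ

  arrow-at-col : ∀ {P i j a} → P ∈ S → j ∈ labelSet P → (i , j , a) ∈ arrows M → (i , j , a) ∈ arrows P
  arrow-at-col mP jP m with arrow-owner m
  ... | Q , mQ , aQ
    with same-member mP mQ jP (Alternative.∈labelSet (alt-member mQ) (proj₁ (proj₂ (Alternative.arrow-cell (alt-member mQ) aQ))))
  ... | refl = aQ

  freeRow-member : ∀ {P l} → P ∈ S → l ∈ labelSet P → isFreeRowᵇ M l ≡ isFreeRowᵇ P l
  freeRow-member {P} {l} mP lP = cong not (any-cong (leftInRow l) (arrows M) (arrows P)
    (λ { {i , _ , _} m e → arrow-at-row mP (subst (_∈ labelSet P) (sym (==⇒≡ {i} {l} (proj₁ (∧-true⁻ e)))) lP) m })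
    (λ m _ → arrow-of-member mP m))

  freeCol-member : ∀ {P l} → P ∈ S → l ∈ labelSet P → isFreeColᵇ M l ≡ isFreeColᵇ P l
  freeCol-member {P} {l} mP lP = cong not (any-cong (upInCol l) (arrows M) (arrows P)
    (λ { {_ , j , _} m e → arrow-at-col mP (subst (_∈ labelSet P) (sym (==⇒≡ {j} {l} (proj₁ (∧-true⁻ e)))) lP) m })
    (λ m _ → arrow-of-member mP m))

  freeRowᵇ-member : ∀ {P x} → P ∈ S → x ∈ labels P → freeRowᵇ M x ≡ freeRowᵇ P x
  freeRowᵇ-member {x = x} mP m = cong (isRowᵇ (proj₂ x) ∧_) (freeRow-member mP (∈-map⁺ proj₁ m))

  freeColᵇ-member : ∀ {P x} → P ∈ S → x ∈ labels P → freeColᵇ M x ≡ freeColᵇ P x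
  freeColᵇ-member {x = x} mP m = cong (isColᵇ (proj₂ x) ∧_) (freeCol-member mP (∈-map⁺ proj₁ m))

  freeᵇ-member : ∀ {P x} → P ∈ S → x ∈ labels P → freeᵇ M x ≡ freeᵇ P x
  freeᵇ-member mP m = cong₂ _∨_ (freeRowᵇ-member mP m) (freeColᵇ-member mP m)

  private
    indicator : Bool → ℕ
    indicator b = if b then 1 else 0

    count-members : ∀ (freeOf : Tableau → ℤ × RC → Bool) (c : Tableau → Bool) →
      (∀ {P x} → P ∈ S → x ∈ labels P → freeOf M x ≡ freeOf P x) →
      (∀ {P} → Packed P → length (filterᵇ (freeOf P) (labels P)) ≡ indicator (c P)) →
      ∀ S′ → (∀ {P} → P ∈ S′ → P ∈ S) → All Packed S′ →
      length (filterᵇ (freeOf M) (concatMap labels S′)) ≡ countᵇ c S′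
    count-members freeOf c member-free per-member [] _ _ = refl
    count-members freeOf c member-free per-member (P ∷ S′) ⊆S (packedP ∷ packedS′) = begin
      length (filterᵇ (freeOf M) (labels P ++ concatMap labels S′))
        ≡⟨ length-filter-++ (freeOf M) (labels P) (concatMap labels S′) ⟩
      length (filterᵇ (freeOf M) (labels P)) + length (filterᵇ (freeOf M) (concatMap labels S′))
        ≡⟨ cong₂ _+_ (cong length (filter-cong _ _ (labels P) (member-free (⊆S (here refl)))))
                     (count-members freeOf c member-free per-member S′ (⊆S ∘ there) packedS′) ⟩
      length (filterᵇ (freeOf P) (labels P)) + countᵇ c S′
        ≡⟨ cong (_+ countᵇ c S′) (per-member packedP) ⟩
      indicator (c P) + countᵇ c S′
        ≡⟨ add-member ⟩
      countᵇ c (P ∷ S′) ∎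
      where
      open ≡-Reasoning
      add-member : indicator (c P) + countᵇ c S′ ≡ countᵇ c (P ∷ S′)
      add-member with c P
      ... | true = refl
      ... | false = refl

    rowCount≡ : ∀ κ → rowCount κ ≡ indicator (isRowᵇ κ)
    rowCount≡ row = refl
    rowCount≡ col = refl

    colCount≡ : ∀ κ → colCount κ ≡ indicator (isColᵇ κ)
    colCount≡ row = refl
    colCount≡ col = refl

    rows-of-packed : ∀ {P} → Packed P → length (filterᵇ (freeRowᵇ P) (labels P)) ≡ indicator (oneRowNoColᵇ P)
    rows-of-packed {P} packedP = let κ , kind = packed-kind packedP in
      trans (sym (Listₚ.length-map proj₁ (filterᵇ (freeRowᵇ P) (labels P))))
            (trans (proj₁ kind) (trans (rowCount≡ κ) (cong indicator (sym (oneRowNoColᵇ-kind {P} κ kind)))))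

    cols-of-packed : ∀ {P} → Packed P → length (filterᵇ (freeColᵇ P) (labels P)) ≡ indicator (noRowOneColᵇ P)
    cols-of-packed {P} packedP = let κ , kind = packed-kind packedP in
      trans (sym (Listₚ.length-map proj₁ (filterᵇ (freeColᵇ P) (labels P))))
            (trans (proj₂ kind) (trans (colCount≡ κ) (cong indicator (sym (noRowOneColᵇ-kind {P} κ kind)))))

  freeRows-M : length (freeRows M) ≡ countᵇ oneRowNoColᵇ S
  freeRows-M = trans (Listₚ.length-map proj₁ (filterᵇ (freeRowᵇ M) (labels M)))
    (trans (length-filter-↭ (freeRowᵇ M) (Merged.labels-↭ merged))
           (count-members freeRowᵇ oneRowNoColᵇ freeRowᵇ-member rows-of-packed S (λ m → m) packed))

  freeCols-M : length (freeCols M) ≡ countᵇ noRowOneColᵇ S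
  freeCols-M = trans (Listₚ.length-map proj₁ (filterᵇ (freeColᵇ M) (labels M)))
    (trans (length-filter-↭ (freeColᵇ M) (Merged.labels-↭ merged))
           (count-members freeColᵇ noRowOneColᵇ freeColᵇ-member cols-of-packed S (λ m → m) packed))

  module Member {P : Tableau} (mP : P ∈ S) {w : ℤ × RC} (w∈P : w ∈ labels P) (w-free : freeᵇ P w ≡ true) where
    private
      altP = alt-member mP
      module AP = Alternative altP
      k = proj₁ w

      inP : ℤ → Bool
      inP l = l ∈ᵇ labelSet P

      -- every walk in P ends at k, the only free label of P
      root-member : ∀ {l} → l ∈ labelSet P → Roots.root altP l ≡ k
      root-member m =
        let κ , m′ , free = Freeness.root-free altP m
            _ , _ , only = one-element (packed-one-free (All.lookup packed mP))
            w∈Free = ∈-map⁺ proj₁ (filter-∈⁺ (freeᵇ P) (labels P) w∈P w-free)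
        in trans (only (∈-map⁺ proj₁ (filter-∈⁺ (freeᵇ P) (labels P) m′ free))) (sym (only w∈Free))

      inP-closed : ∀ {i j a} → (i , j , a) ∈ arrows M → inP i ≡ inP j
      inP-closed {i} {j} m with inP i in ei | inP j in ej
      ... | true | true = refl
      ... | false | false = refl
      ... | true | false = ⊥-elim (true≢false (trans (sym (proj₂ (AP.arrow-ends (arrow-at-row mP (∈ᵇ⇒∈ _ ei) m)))) ej))
      ... | false | true = ⊥-elim (true≢false (trans (sym (proj₁ (AP.arrow-ends (arrow-at-col mP (∈ᵇ⇒∈ _ ej) m)))) ei))

      component-k : component M k ≡ filterᵇ inP (labelSet M)
      component-k = Component.component≡ alt-M inP (∈-map⁺ proj₁ (label-of-member mP w∈P))
        (∈⇒∈ᵇ _ (AP.∈labelSet w∈P)) inP-closed least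
        where
        least : ∀ X → ClosedUnder (arrows M) X → (k ∈ᵇ X) ≡ true → ∀ {l} → inP l ≡ true → (l ∈ᵇ X) ≡ true
        least X closed kX {l} e = trans (Roots.root-closed altP X (closed ∘ arrow-of-member mP) l)
                                        (trans (cong (_∈ᵇ X) (root-member (∈ᵇ⇒∈ _ e))) kX)

      restrictBy-P : restrictBy M inP ≡ P
      restrictBy-P = cong₂ tab
        (LabelOrder.sorted-ext (λ {x} → <lab-irrefl {x})
          (LabelOrder.sorted-filter _ (Alternative.labels-sorted alt-M)) AP.labels-sorted
          (λ m → let mM , e = filter-∈⁻ (inP ∘ proj₁) (labels M) m
                     Q , mQ , zQ = label-owner mM
                 in subst (λ R → _ ∈ labels R) (sym (same-member mP mQ (∈ᵇ⇒∈ _ e) (∈-map⁺ proj₁ zQ))) zQ)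
          (λ m → filter-∈⁺ (inP ∘ proj₁) (labels M) (label-of-member mP m) (∈⇒∈ᵇ _ (AP.∈labelSet m))))
        (CellOrder.sorted-ext (λ {x} → <cell-irrefl {x})
          (CellOrder.sorted-filter _ (Alternative.arrows-sorted alt-M)) AP.arrows-sorted
          (λ m → let mM , e = filter-∈⁻ _ (arrows M) m in arrow-at-row mP (∈ᵇ⇒∈ _ (proj₁ (∧-true⁻ e))) mM)
          (λ m → let e₁ , e₂ = AP.arrow-ends m in filter-∈⁺ _ (arrows M) (arrow-of-member mP m) (∧-true⁺ e₁ e₂)))

    restrictAt-member : restrictAt M k ≡ P
    restrictAt-member = begin
      restrict M (component M k)                     ≡⟨ cong (restrict M) component-k ⟩
      restrict M (filterᵇ inP (labelSet M))          ≡⟨ Restriction.restrict≡restrictBy alt-M inP ⟩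
      restrictBy M inP                               ≡⟨ restrictBy-P ⟩
      P                                              ∎
      where open ≡-Reasoning

  split-M : split M ∼[ set ] S
  split-M = mk⇔ to from
    where
    to : ∀ {Q} → Q ∈ split M → Q ∈ S
    to m with ∈-map⁻ (restrictAt M) m
    ... | k , mk , refl with ∈-map⁻ proj₁ mk
    ... | w , mw , refl with filter-∈⁻ (freeᵇ M) (labels M) mw
    ... | wM , free with label-owner wM
    ... | P , mP , wP = subst (_∈ S) (sym (Member.restrictAt-member mP wP (trans (sym (freeᵇ-member mP wP)) free))) mP
    from : ∀ {P} → P ∈ S → P ∈ split M
    from {P} mP with one-element (packed-one-free (All.lookup packed mP))
    ... | k , mk , _ with ∈-map⁻ proj₁ mk
    ... | w , mw , refl with filter-∈⁻ (freeᵇ P) (labels P) mw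
    ... | wP , free = subst (_∈ split M) (Member.restrictAt-member mP wP free)
      (∈-map⁺ (restrictAt M) (∈-map⁺ proj₁ (filter-∈⁺ (freeᵇ M) (labels M) (label-of-member mP wP)
        (trans (freeᵇ-member mP wP) free))))

  labelSet-M : ∀ {L} → Linked _<_ L → concatMap labelSet S ↭ L → labelSet M ≡ L
  labelSet-M sortedL partition = IntOrder.sorted-ext (ℤₚ.<-irrefl refl)
    (Linkedₚ.map⁺ (Alternative.labels-sorted alt-M)) sortedL
    (λ m → let w , mw , l≡ = ∈-map⁻ proj₁ m
               P , mP , wP = label-owner mw
           in Permₚ.∈-resp-↭ partition (∈-concatMap⁺ labelSet mP (subst (_∈ labelSet P) (sym l≡) (∈-map⁺ proj₁ wP))))
    (λ m → let P , mP , lP = ∈-concatMap⁻ labelSet S (Permₚ.∈-resp-↭ (↭-sym partition) m)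
               w , mw , l≡ = ∈-map⁻ proj₁ lP
           in subst (_∈ labelSet M) (sym l≡) (∈-map⁺ proj₁ (label-of-member mP mw)))

partition-disjoint : ∀ {S L} → Linked _<_ L → concatMap labelSet S ↭ L → Unique (concatMap labelSet S)
partition-disjoint sortedL partition =
  PermSₚ.Unique-resp-↭ (setoid ℤ) (↭⇒↭ₛ (↭-sym partition)) (IntOrder.sorted⇒unique (ℤₚ.<-irrefl refl) sortedL)

split-Side2 : ∀ {L i j T} → Side1 L i j T → Side2 L i j (split T)
split-Side2 {L} {i} {j} {T} (alt , labels≡L , rows≡i , cols≡j) = subst (Side2 L i j) (sym split≡pieces)
  ( pieces-unique
  , Allₚ.map⁺ (All.tabulate piece-packed)
  , trans pieces-length (cong₂ _+_ rows≡i cols≡j)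
  , trans pieces-rowKind rows≡i
  , trans pieces-colKind cols≡j
  , subst (concatMap labelSet pieces ↭_) labels≡L pieces-partition )
  where open SplitOf alt

merge-split : ∀ {L i j T} → Side1 L i j T → mergeAll (split T) ≡ T
merge-split (alt , _) = trans (cong mergeAll split≡pieces) merge-pieces
  where open SplitOf alt

merge-Side1 : ∀ {L i j S} → Linked _<_ L → Side2 L i j S → Side1 L i j (mergeAll S)
merge-Side1 {S = S} sortedL (_ , packed , _ , rows≡i , cols≡j , partition) =
  alt-M , labelSet-M sortedL partition , trans freeRows-M rows≡i , trans freeCols-M cols≡j
  where open MergeOf packed (partition-disjoint {S} sortedL partition)

split-merge : ∀ {L i j S} → Linked _<_ L → Side2 L i j S → split (mergeAll S) ∼[ set ] S
split-merge {S = S} sortedL (_ , packed , _ , _ , _ , partition) =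
  MergeOf.split-M packed (partition-disjoint {S} sortedL partition)

theorem2p14 : (i j : ℕ) (L : List ℤ) → Linked _<_ L →
    ((T : Tableau) → Side1 L i j T → Side2 L i j (split T) × (mergeAll (split T) ≡ T))
    × ((S : List Tableau) → Side2 L i j S → Side1 L i j (mergeAll S) × (split (mergeAll S) ∼[ set ] S))
theorem2p14 i j L sortedL =
  (λ T side1 → split-Side2 side1 , merge-split side1) ,
  (λ S side2 → merge-Side1 sortedL side2 , split-merge sortedL side2)
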